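{- Let $p$ be a prime, $k\geq 1$, and let $\mathcal{F}=\{F_1,\dots,F_k\}$ be a finite family of pairwise non-isomorphic order-$p$ reduced graphs without multiple edges that is closed under surjective homomorphic image. Then the $k\times k$ matrix $M=[\hom(F_i,F_j)\bmod p]_{i,j=1}^k$ is nonsingular over the field $\mathbb{Z}_p$.
   Context: Graphs are finite, undirected, may have loops. A homomorphism $G\to H$ is a map $V(G)\to V(H)$ sending edges to edges; $\hom(G,H)$ is the number of homomorphisms. A homomorphism is surjective if it is surjective on vertices and on edges; $\mathrm{surj}(G,H)$ denotes the number of such. A graph is order-$p$ reduced if it has no automorphism of order $p$ (a non-identity automorphism $\varrho$ with $\varrho^p=\mathrm{id}$). In this (modular) setting, $\mathcal{F}$ is closed under surjective homomorphic image if for every $F\in\mathcal{F}$ and every order-$p$ reduced graph $J$ with $\mathrm{surj}(F,J)\not\equiv 0\pmod p$, $J$ is isomorphic to a member of $\mathcal{F}$. -}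

module Defs where

open import Data.Nat using (ℕ; zero; suc; _+_; _*_; ∣_-_∣)
open import Data.Nat.Divisibility using (_∣_)
open import Data.Fin using (Fin; zero; suc; _≟_)
open import Data.Bool using (Bool; true; false; _∧_; _∨_; not; if_then_else_)
open import Data.List using (List; []; _∷_; map; concatMap; allFin; filter; length)
open import Data.Bool.ListAction using (all; any)
open import Data.Nat.ListAction using (sum)
open import Data.Vec.Functional using () renaming (_∷_ to _∷ᶠ_)
open import Data.Product using (Σ; _×_; ∃)
open import Relation.Binary.PropositionalEquality using (_≡_; _≢_)
open import Relation.Nullary using (¬_; does)
open import Function.Definitions using (Injective)
open import Relation.Nullary.Decidable using (T?)

-- A finite undirected graph, loops allowed, no multiple edges:
-- vertex set Fin size, symmetric Boolean adjacency relation.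
record Graph : Set where
  field
    size : ℕ
    adj  : Fin size → Fin size → Bool
    sym  : ∀ x y → adj x y ≡ adj y x
open Graph public

allFuns : (n m : ℕ) → List (Fin n → Fin m)
allFuns zero    m = (λ ()) ∷ []
allFuns (suc n) m = concatMap (λ f → map (λ a → a ∷ᶠ f) (allFin m)) (allFuns n m)

_⇒ᵇ_ : Bool → Bool → Bool
a ⇒ᵇ b = not a ∨ b

isHom : (G H : Graph) → (Fin (size G) → Fin (size H)) → Bool
isHom G H f = all (λ x → all (λ y → adj G x y ⇒ᵇ adj H (f x) (f y)) (allFin (size G))) (allFin (size G))

isVertexSurj : (G H : Graph) → (Fin (size G) → Fin (size H)) → Bool
isVertexSurj G H f = all (λ u → any (λ x → does (f x ≟ u)) (allFin (size G))) (allFin (size H))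

isEdgeSurj : (G H : Graph) → (Fin (size G) → Fin (size H)) → Bool
isEdgeSurj G H f =
  all (λ u → all (λ v → adj H u v ⇒ᵇ
    any (λ x → any (λ y → adj G x y ∧ does (f x ≟ u) ∧ does (f y ≟ v)) (allFin (size G))) (allFin (size G)))
    (allFin (size H))) (allFin (size H))

hom : Graph → Graph → ℕ
hom G H = length (filter (λ f → T? (isHom G H f)) (allFuns (size G) (size H)))

surj : Graph → Graph → ℕ
surj G H = length (filter (λ f → T? (isHom G H f ∧ isVertexSurj G H f ∧ isEdgeSurj G H f))
                          (allFuns (size G) (size H)))

iter : ∀ {n} → ℕ → (Fin n → Fin n) → Fin n → Fin n
iter zero    ρ x = x
iter (suc k) ρ x = ρ (iter k ρ x)

AutOfOrder : ℕ → Graph → Set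
AutOfOrder p G =
  Σ (Fin (size G) → Fin (size G)) λ ρ →
    Injective _≡_ _≡_ ρ ×
    (∀ x y → adj G (ρ x) (ρ y) ≡ adj G x y) ×
    (∃ λ x → ρ x ≢ x) ×
    (∀ x → iter p ρ x ≡ x)

OrderReduced : ℕ → Graph → Set
OrderReduced p G = ¬ AutOfOrder p G

Iso : Graph → Graph → Set
Iso G H =
  Σ (Fin (size G) → Fin (size H)) λ f →
  Σ (Fin (size H) → Fin (size G)) λ g →
    (∀ x → g (f x) ≡ x) × (∀ y → f (g y) ≡ y) ×
    (∀ x y → adj H (f x) (f y) ≡ adj G x y)

_≡_[mod_] : ℕ → ℕ → ℕ → Set
a ≡ b [mod p ] = p ∣ ∣ a - b ∣

δ : ∀ {k} → Fin k → Fin k → ℕ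
δ i j = if does (i ≟ j) then 1 else 0

mulEntry : ∀ {k} → (Fin k → Fin k → ℕ) → (Fin k → Fin k → ℕ) → Fin k → Fin k → ℕ
mulEntry {k} A B i j = sum (map (λ l → A i l * B l j) (allFin k))

NonsingularMod : (p : ℕ) {k : ℕ} → (Fin k → Fin k → ℕ) → Set
NonsingularMod p {k} M =
  Σ (Fin k → Fin k → ℕ) λ N →
    (∀ i j → mulEntry M N i j ≡ δ i j [mod p ]) ×
    (∀ i j → mulEntry N M i j ≡ δ i j [mod p ])

ClosedSurjImage : (p : ℕ) {k : ℕ} → (Fin k → Graph) → Set
ClosedSurjImage p {k} F =
  ∀ i (J : Graph) → OrderReduced p J → ¬ (p ∣ surj (F i) J) → ∃ λ j → Iso J (F j)

-- Every homomorphism Fᵢ → Fⱼ is a surjective homomorphism onto a subgraph S of Fⱼ, so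
-- hom(Fᵢ, Fⱼ) = ∑_S surj(Fᵢ, S). Modulo p the term for S vanishes unless S is order-p reduced (an
-- automorphism of order p permutes the surjections in orbits of size p), and then closure makes S
-- isomorphic to a unique Fₗ. Hence hom ≡ A · C (mod p) with A i l = surj(Fᵢ, Fₗ) and C l j the number of
-- subgraphs of Fⱼ isomorphic to Fₗ. Ordered by size, A is triangular with diagonal entries
-- surj(Fᵢ, Fᵢ) = |Aut Fᵢ|, which p does not divide by McKay's proof of Cauchy's theorem since Fᵢ has no
-- automorphism of order p. Ordered by weight (vertices plus edges), C is unitriangular.
module Submission where

open import Defs renaming (sym to adj-sym)
open import Level using (0ℓ)
open import Function using (_∘_; id)
open import Function.Bundles using (Equivalence)
open import Data.Empty using (⊥; ⊥-elim)
open import Data.Unit using (tt)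
open import Data.Product using (Σ; _×_; _,_; proj₁; proj₂; ∃; ∃₂)
open import Data.Product.Relation.Binary.Pointwise.NonDependent using (×-decSetoid)
open import Data.Sum using (_⊎_; inj₁; inj₂)
import Data.Sum as Sum
open import Data.Bool using (Bool; true; false; _∧_; _∨_; not; T; if_then_else_)
open import Data.Bool.ListAction using (all; any)
import Data.Bool.Properties as Bool
open import Data.Nat using (ℕ; zero; suc; _+_; _*_; _∸_; _^_; _≤_; _<_; z≤n; s≤s; _≡ᵇ_; _<ᵇ_)
open import Data.Nat.Properties hiding (_≟_)
open import Data.Nat.ListAction using (sum)
open import Data.Nat.Divisibility using (_∣_; divides; _∣?_; ∣1⇒≡1; ∣m⇒∣m*n)
open import Data.Nat.Primality using (Prime; prime⇒irreducible; ¬prime[1])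
open import Data.Nat.Coprimality using (Coprime; coprime-Bézout; prime⇒coprime)
open import Data.Nat.GCD using (module Bézout)
open import Data.Nat.Tactic.RingSolver using (solve-∀)
open import Data.Fin using (Fin; zero; suc; _≟_)
open import Data.Fin.Properties using (all?; ¬∀⟶∃¬; injective⇒≤) renaming (suc-injective to fin-suc-injective)
import Data.Fin.Properties as Fin
open import Data.List using (List; []; _∷_; map; concatMap; _++_; length; filter; tabulate; allFin; replicate; cartesianProduct; downFrom)
open import Data.List.Properties using (length-tabulate; ++-assoc; ++-identityʳ; length-++; length-replicate; length-downFrom)
open import Data.List.Relation.Unary.All using (All; []; _∷_)
import Data.List.Relation.Binary.Pointwise as ListPointwise
open import Data.Vec.Functional using () renaming (_∷_ to _∷ᶠ_)
import Data.Vec.Functional.Relation.Binary.Pointwise.Properties as FunPointwise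
open import Relation.Binary.Bundles using (DecSetoid; Setoid)
open import Relation.Binary.Core using (_Preserves_⟶_)
import Relation.Binary.Reasoning.Setoid as SetoidReasoning
open import Relation.Binary.PropositionalEquality
open import Relation.Nullary using (¬_; Dec; yes; no; does)
open import Relation.Nullary.Decidable using (T?; dec-true)
open import Algebra.Properties.CommutativeSemigroup +-commutativeSemigroup using (interchange)

∑ : ∀ {a} {A : Set a} → List A → (A → ℕ) → ℕ
∑ xs f = sum (map f xs)

⌊_⌋ : Bool → ℕ
⌊ true ⌋ = 1
⌊ false ⌋ = 0

module _ {a} {A : Set a} where

  ∑-cong : (xs : List A) {f g : A → ℕ} → (∀ x → f x ≡ g x) → ∑ xs f ≡ ∑ xs g
  ∑-cong []       f≡g = refl
  ∑-cong (x ∷ xs) f≡g = cong₂ _+_ (f≡g x) (∑-cong xs f≡g)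

  ∑-cong-All : (xs : List A) {f g : A → ℕ} → All (λ x → f x ≡ g x) xs → ∑ xs f ≡ ∑ xs g
  ∑-cong-All []       []             = refl
  ∑-cong-All (x ∷ xs) (fx≡gx ∷ f≡g) = cong₂ _+_ fx≡gx (∑-cong-All xs f≡g)

  ∑-+ : (xs : List A) (f g : A → ℕ) → ∑ xs (λ x → f x + g x) ≡ ∑ xs f + ∑ xs g
  ∑-+ []       f g = refl
  ∑-+ (x ∷ xs) f g = trans (cong (f x + g x +_) (∑-+ xs f g)) (interchange (f x) (g x) (∑ xs f) (∑ xs g))

  ∑-*ˡ : (xs : List A) (c : ℕ) (f : A → ℕ) → ∑ xs (λ x → c * f x) ≡ c * ∑ xs f
  ∑-*ˡ []       c f = sym (*-zeroʳ c)
  ∑-*ˡ (x ∷ xs) c f = trans (cong (c * f x +_) (∑-*ˡ xs c f)) (sym (*-distribˡ-+ c (f x) (∑ xs f)))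

  ∑-*ʳ : (xs : List A) (c : ℕ) (f : A → ℕ) → ∑ xs (λ x → f x * c) ≡ ∑ xs f * c
  ∑-*ʳ xs c f = trans (∑-cong xs (λ x → *-comm (f x) c)) (trans (∑-*ˡ xs c f) (*-comm c (∑ xs f)))

  ∑-≡0 : (xs : List A) {f : A → ℕ} → (∀ x → f x ≡ 0) → ∑ xs f ≡ 0
  ∑-≡0 []       f≡0 = refl
  ∑-≡0 (x ∷ xs) f≡0 = cong₂ _+_ (f≡0 x) (∑-≡0 xs f≡0)

  ∑-++ : (xs ys : List A) (f : A → ℕ) → ∑ (xs ++ ys) f ≡ ∑ xs f + ∑ ys f
  ∑-++ []       ys f = refl
  ∑-++ (x ∷ xs) ys f = trans (cong (f x +_) (∑-++ xs ys f)) (sym (+-assoc (f x) (∑ xs f) (∑ ys f)))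

  ∑-mono-≤ : (xs : List A) {f g : A → ℕ} → (∀ x → f x ≤ g x) → ∑ xs f ≤ ∑ xs g
  ∑-mono-≤ []       f≤g = z≤n
  ∑-mono-≤ (x ∷ xs) f≤g = +-mono-≤ (f≤g x) (∑-mono-≤ xs f≤g)

  ∑-1≡length : (xs : List A) → ∑ xs (λ _ → 1) ≡ length xs
  ∑-1≡length []       = refl
  ∑-1≡length (x ∷ xs) = cong suc (∑-1≡length xs)

  length-filter≡∑ : (xs : List A) (b : A → Bool) → length (filter (λ x → T? (b x)) xs) ≡ ∑ xs (λ x → ⌊ b x ⌋)
  length-filter≡∑ []       b = refl
  length-filter≡∑ (x ∷ xs) b with b x
  ... | true  = cong suc (length-filter≡∑ xs b)
  ... | false = length-filter≡∑ xs b

module _ {a b} {A : Set a} {B : Set b} where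

  ∑-map : (xs : List A) (h : A → B) (f : B → ℕ) → ∑ (map h xs) f ≡ ∑ xs (f ∘ h)
  ∑-map []       h f = refl
  ∑-map (x ∷ xs) h f = cong (f (h x) +_) (∑-map xs h f)

  ∑-concatMap : (xs : List A) (h : A → List B) (f : B → ℕ) → ∑ (concatMap h xs) f ≡ ∑ xs (λ x → ∑ (h x) f)
  ∑-concatMap []       h f = refl
  ∑-concatMap (x ∷ xs) h f = trans (∑-++ (h x) (concatMap h xs) f) (cong (∑ (h x) f +_) (∑-concatMap xs h f))

  ∑-comm : (xs : List A) (ys : List B) (g : A → B → ℕ) →
           ∑ xs (λ x → ∑ ys (λ y → g x y)) ≡ ∑ ys (λ y → ∑ xs (λ x → g x y))
  ∑-comm []       ys g = sym (∑-≡0 ys (λ _ → refl))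
  ∑-comm (x ∷ xs) ys g = trans (cong (∑ ys (g x) +_) (∑-comm xs ys g)) (sym (∑-+ ys (g x) (λ y → ∑ xs (λ x → g x y))))

∑-tabulate : ∀ {a} {A : Set a} {n} (h : Fin n → A) (f : A → ℕ) → ∑ (tabulate h) f ≡ ∑ (allFin n) (f ∘ h)
∑-tabulate {n = zero}  h f = refl
∑-tabulate {n = suc n} h f = cong (f (h zero) +_) (trans (∑-tabulate (h ∘ suc) f) (sym (∑-tabulate suc (f ∘ h))))

∑-allFin-suc : ∀ {n} (f : Fin (suc n) → ℕ) → ∑ (allFin (suc n)) f ≡ f zero + ∑ (allFin n) (f ∘ suc)
∑-allFin-suc f = cong (f zero +_) (∑-tabulate suc f)

∑-allFin-1 : ∀ n → ∑ (allFin n) (λ _ → 1) ≡ n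
∑-allFin-1 n = trans (∑-1≡length (allFin n)) (length-tabulate id)

∑-allFin-≥ : ∀ n (h : Fin n → ℕ) x → h x ≤ ∑ (allFin n) h
∑-allFin-≥ (suc n) h zero    = subst (h zero ≤_) (sym (∑-allFin-suc h)) (m≤m+n (h zero) _)
∑-allFin-≥ (suc n) h (suc x) =
  subst (h (suc x) ≤_) (sym (∑-allFin-suc h)) (≤-trans (∑-allFin-≥ n (h ∘ suc) x) (m≤n+m _ (h zero)))

+-≤-≡-split : ∀ {a b c d} → a ≤ c → b ≤ d → a + b ≡ c + d → a ≡ c × b ≡ d
+-≤-≡-split {a} {b} {c} {d} a≤c b≤d a+b≡c+d = a≡c , +-cancelˡ-≡ a b d (trans a+b≡c+d (cong (_+ d) (sym a≡c)))
  where
  a≡c : a ≡ c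
  a≡c = ≤-antisym a≤c (+-cancelʳ-≤ d c a (≤-trans (≤-reflexive (sym a+b≡c+d)) (+-monoʳ-≤ a b≤d)))

∑-mono-≤-≡⇒≗ : ∀ n (f g : Fin n → ℕ) → (∀ x → f x ≤ g x) → ∑ (allFin n) f ≡ ∑ (allFin n) g → ∀ x → f x ≡ g x
∑-mono-≤-≡⇒≗ (suc n) f g f≤g ∑f≡∑g x
  with +-≤-≡-split (f≤g zero) (∑-mono-≤ (allFin n) (f≤g ∘ suc))
                   (trans (sym (∑-allFin-suc f)) (trans ∑f≡∑g (∑-allFin-suc g)))
∑-mono-≤-≡⇒≗ (suc n) f g f≤g ∑f≡∑g zero    | f0≡g0 , _ = f0≡g0
∑-mono-≤-≡⇒≗ (suc n) f g f≤g ∑f≡∑g (suc x) | _ , rest = ∑-mono-≤-≡⇒≗ n (f ∘ suc) (g ∘ suc) (f≤g ∘ suc) rest x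

⌊∧⌋ : ∀ a b → ⌊ a ∧ b ⌋ ≡ ⌊ a ⌋ * ⌊ b ⌋
⌊∧⌋ true  b = sym (+-identityʳ ⌊ b ⌋)
⌊∧⌋ false b = refl

⌊⌋≤1 : ∀ a → ⌊ a ⌋ ≤ 1
⌊⌋≤1 true  = s≤s z≤n
⌊⌋≤1 false = z≤n

T-does⁻ : ∀ {p} {P : Set p} (d : Dec P) → T (does d) → P
T-does⁻ (yes p) _ = p

T-does⁺ : ∀ {p} {P : Set p} (d : Dec P) → P → T (does d)
T-does⁺ (yes _) _ = tt
T-does⁺ (no ¬p) p = ¬p p

T-∧⁻ : ∀ {a b} → T (a ∧ b) → T a × T b
T-∧⁻ {true} {true} _ = tt , tt

T-∧⁺ : ∀ {a b} → T a → T b → T (a ∧ b)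
T-∧⁺ {true} {true} _ _ = tt

T-⇒ᵇ⁻ : ∀ {a b} → T (a ⇒ᵇ b) → T a → T b
T-⇒ᵇ⁻ {true} t _ = t

T-⇒ᵇ⁺ : ∀ {a b} → (T a → T b) → T (a ⇒ᵇ b)
T-⇒ᵇ⁺ {true}  f = f tt
T-⇒ᵇ⁺ {false} f = tt

T⇒≡true : ∀ {b} → T b → b ≡ true
T⇒≡true {true} _ = refl

≡true⇒T : ∀ {b} → b ≡ true → T b
≡true⇒T refl = tt

T⇔T⇒≡ : ∀ b c → (T b → T c) → (T c → T b) → b ≡ c
T⇔T⇒≡ true  true  f g = refl
T⇔T⇒≡ true  false f g = ⊥-elim (f tt)
T⇔T⇒≡ false true  f g = ⊥-elim (g tt)
T⇔T⇒≡ false false f g = refl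

⌊T⌋ : ∀ {b} → T b → ⌊ b ⌋ ≡ 1
⌊T⌋ {true} _ = refl

⌊¬T⌋ : ∀ {b} → ¬ T b → ⌊ b ⌋ ≡ 0
⌊¬T⌋ {true}  ¬t = ⊥-elim (¬t tt)
⌊¬T⌋ {false} _  = refl

⌊⌋≡⌊∧⌋ : ∀ {a b} → (T a → T b) → ⌊ a ⌋ ≡ ⌊ a ∧ b ⌋
⌊⌋≡⌊∧⌋ {false} _   = refl
⌊⌋≡⌊∧⌋ {true}  a⇒b = sym (⌊T⌋ (a⇒b tt))

⌊does⌋-× : ∀ {P Q R : Set} (P? : Dec P) (Q? : Dec Q) (R? : Dec R) → (R → P × Q) → (P → Q → R) →
           ⌊ does R? ⌋ ≡ ⌊ does P? ⌋ * ⌊ does Q? ⌋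
⌊does⌋-× (yes p) (yes q) (yes r) f g = refl
⌊does⌋-× (yes p) (yes q) (no ¬r) f g = ⊥-elim (¬r (g p q))
⌊does⌋-× (yes p) (no ¬q) (yes r) f g = ⊥-elim (¬q (proj₂ (f r)))
⌊does⌋-× (yes p) (no ¬q) (no ¬r) f g = refl
⌊does⌋-× (no ¬p) Q?      (yes r) f g = ⊥-elim (¬p (proj₁ (f r)))
⌊does⌋-× (no ¬p) Q?      (no ¬r) f g = refl

module _ {A : Set} where

  T-all-tabulate⁻ : ∀ {n} (h : Fin n → A) (f : A → Bool) → T (all f (tabulate h)) → ∀ i → T (f (h i))
  T-all-tabulate⁻ h f t zero    = proj₁ (T-∧⁻ {f (h zero)} t)
  T-all-tabulate⁻ h f t (suc i) = T-all-tabulate⁻ (h ∘ suc) f (proj₂ (T-∧⁻ {f (h zero)} t)) i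

  T-all-tabulate⁺ : ∀ {n} (h : Fin n → A) (f : A → Bool) → (∀ i → T (f (h i))) → T (all f (tabulate h))
  T-all-tabulate⁺ {zero}  h f t = tt
  T-all-tabulate⁺ {suc n} h f t = T-∧⁺ {f (h zero)} (t zero) (T-all-tabulate⁺ (h ∘ suc) f (t ∘ suc))

  T-any⁻ : (f : A → Bool) (xs : List A) → T (any f xs) → ∃ λ x → T (f x)
  T-any⁻ f (x ∷ xs) t with f x in fx
  ... | true  = x , ≡true⇒T fx
  ... | false = T-any⁻ f xs t

  T-any-tabulate⁻ : ∀ {n} (h : Fin n → A) (f : A → Bool) → T (any f (tabulate h)) → ∃ λ i → T (f (h i))
  T-any-tabulate⁻ {suc n} h f t with f (h zero) in fh0
  ... | true  = zero , ≡true⇒T fh0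
  ... | false with T-any-tabulate⁻ (h ∘ suc) f t
  ...   | i , fhi = suc i , fhi

  T-any-tabulate⁺ : ∀ {n} (h : Fin n → A) (f : A → Bool) i → T (f (h i)) → T (any f (tabulate h))
  T-any-tabulate⁺ h f zero    t with f (h zero)
  ... | true = tt
  T-any-tabulate⁺ h f (suc i) t with f (h zero)
  ... | true  = tt
  ... | false = T-any-tabulate⁺ (h ∘ suc) f i t

  ∑⌊⌋-pos⇒T-any : (f : A → Bool) (xs : List A) → 1 ≤ ∑ xs (λ x → ⌊ f x ⌋) → T (any f xs)
  ∑⌊⌋-pos⇒T-any f (x ∷ xs) 1≤∑ with f x
  ... | true  = tt
  ... | false = ∑⌊⌋-pos⇒T-any f xs 1≤∑

  any-mono : (f g : A → Bool) (xs : List A) → (∀ x → T (f x) → T (g x)) → T (any f xs) → T (any g xs)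
  any-mono f g (x ∷ xs) f⇒g t with f x in fx | g x in gx
  ... | _     | true  = tt
  ... | true  | false = ⊥-elim (subst T gx (f⇒g x (≡true⇒T fx)))
  ... | false | false = any-mono f g xs f⇒g t

T-all⁻ : ∀ {n} (f : Fin n → Bool) → T (all f (allFin n)) → ∀ i → T (f i)
T-all⁻ = T-all-tabulate⁻ id

T-all⁺ : ∀ {n} (f : Fin n → Bool) → (∀ i → T (f i)) → T (all f (allFin n))
T-all⁺ = T-all-tabulate⁺ id

T-anyFin⁻ : ∀ {n} (f : Fin n → Bool) → T (any f (allFin n)) → ∃ λ i → T (f i)
T-anyFin⁻ = T-any-tabulate⁻ id

T-anyFin⁺ : ∀ {n} (f : Fin n → Bool) i → T (f i) → T (any f (allFin n))
T-anyFin⁺ = T-any-tabulate⁺ id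

-- Finite sets are lists enumerating a decidable setoid: every element occurs exactly once up to ≈.
module Enumeration (D : DecSetoid 0ℓ 0ℓ) where
  open DecSetoid D using (Carrier; _≈_) renaming (_≟_ to _≈?_; sym to ≈-sym; trans to ≈-trans)

  infix 4 _≈ᵇ_
  _≈ᵇ_ : Carrier → Carrier → Bool
  x ≈ᵇ y = does (x ≈? y)

  EnumeratesOn : List Carrier → (Carrier → Set) → Set
  EnumeratesOn xs P = ∀ y → P y → ∑ xs (λ x → ⌊ x ≈ᵇ y ⌋) ≡ 1

  Enumerates : List Carrier → Set
  Enumerates xs = ∀ y → ∑ xs (λ x → ⌊ x ≈ᵇ y ⌋) ≡ 1

  ≈ᵇ-respʳ : ∀ x {y y'} → y ≈ y' → (x ≈ᵇ y) ≡ (x ≈ᵇ y')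
  ≈ᵇ-respʳ x y≈y' = T⇔T⇒≡ _ _ (λ t → T-does⁺ (x ≈? _) (≈-trans (T-does⁻ (x ≈? _) t) y≈y'))
                              (λ t → T-does⁺ (x ≈? _) (≈-trans (T-does⁻ (x ≈? _) t) (≈-sym y≈y')))

  ≈ᵇ-respˡ : ∀ {x x'} y → x ≈ x' → (x ≈ᵇ y) ≡ (x' ≈ᵇ y)
  ≈ᵇ-respˡ y x≈x' = T⇔T⇒≡ _ _ (λ t → T-does⁺ (_ ≈? y) (≈-trans (≈-sym x≈x') (T-does⁻ (_ ≈? y) t)))
                               (λ t → T-does⁺ (_ ≈? y) (≈-trans x≈x' (T-does⁻ (_ ≈? y) t)))

  ⌊≈ᵇ⌋*-cong : (g : Carrier → ℕ) → g Preserves _≈_ ⟶ _≡_ → ∀ x y → ⌊ x ≈ᵇ y ⌋ * g x ≡ ⌊ x ≈ᵇ y ⌋ * g y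
  ⌊≈ᵇ⌋*-cong g g-resp x y with x ≈? y
  ... | yes x≈y = cong (_+ 0) (g-resp x≈y)
  ... | no  _   = refl

  ∑-select : ∀ xs y → ∑ xs (λ x → ⌊ x ≈ᵇ y ⌋) ≡ 1 → (g : Carrier → ℕ) → g Preserves _≈_ ⟶ _≡_ →
             ∑ xs (λ x → ⌊ x ≈ᵇ y ⌋ * g x) ≡ g y
  ∑-select xs y once g g-resp = begin
      ∑ xs (λ x → ⌊ x ≈ᵇ y ⌋ * g x) ≡⟨ ∑-cong xs (λ x → ⌊≈ᵇ⌋*-cong g g-resp x y) ⟩
      ∑ xs (λ x → ⌊ x ≈ᵇ y ⌋ * g y) ≡⟨ ∑-*ʳ xs (g y) _ ⟩
      ∑ xs (λ x → ⌊ x ≈ᵇ y ⌋) * g y ≡⟨ cong (_* g y) once ⟩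
      1 * g y                       ≡⟨ *-identityˡ (g y) ⟩
      g y                           ∎
    where open ≡-Reasoning

  ∑-partition : ∀ {A : Set} (xs : List A) (ys : List Carrier) (key : A → Carrier) (f : A → ℕ) →
                Enumerates ys → ∑ xs f ≡ ∑ ys (λ y → ∑ xs (λ x → ⌊ y ≈ᵇ key x ⌋ * f x))
  ∑-partition xs ys key f enum = begin
      ∑ xs f                                            ≡⟨ ∑-cong xs (λ x → sym (*-identityˡ (f x))) ⟩
      ∑ xs (λ x → 1 * f x)                              ≡⟨ ∑-cong xs (λ x → cong (_* f x) (sym (enum (key x)))) ⟩
      ∑ xs (λ x → ∑ ys (λ y → ⌊ y ≈ᵇ key x ⌋) * f x)     ≡⟨ ∑-cong xs (λ x → sym (∑-*ʳ ys (f x) _)) ⟩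
      ∑ xs (λ x → ∑ ys (λ y → ⌊ y ≈ᵇ key x ⌋ * f x))     ≡⟨ ∑-comm xs ys _ ⟩
      ∑ ys (λ y → ∑ xs (λ x → ⌊ y ≈ᵇ key x ⌋ * f x))     ∎
    where open ≡-Reasoning

open Enumeration public using (_≈ᵇ_; Enumerates; EnumeratesOn)

module _ (DX DY : DecSetoid 0ℓ 0ℓ) where
  private
    module X = DecSetoid DX
    module Y = DecSetoid DY

  count-bijection : (xs : List X.Carrier) (ys : List Y.Carrier) (P : X.Carrier → Bool) (Q : Y.Carrier → Bool)
    (ψ : Y.Carrier → X.Carrier) → Enumerates DX xs → Enumerates DY ys →
    P Preserves X._≈_ ⟶ _≡_ → Q Preserves Y._≈_ ⟶ _≡_ → ψ Preserves Y._≈_ ⟶ X._≈_ →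
    (∀ y → T (Q y) → T (P (ψ y))) →
    (∀ y y' → T (Q y) → T (Q y') → ψ y X.≈ ψ y' → y Y.≈ y') →
    (∀ x → T (P x) → ∃ λ y → T (Q y) × ψ y X.≈ x) →
    ∑ ys (λ y → ⌊ Q y ⌋) ≡ ∑ xs (λ x → ⌊ P x ⌋)
  count-bijection xs ys P Q ψ enumX enumY P-resp Q-resp ψ-resp ψ-into ψ-inj ψ-onto = begin
      ∑ ys (λ y → ⌊ Q y ⌋)
        ≡⟨ ∑-cong ys (λ y → sym (trans (cong (⌊ Q y ⌋ *_) (enumX (ψ y))) (*-identityʳ _))) ⟩
      ∑ ys (λ y → ⌊ Q y ⌋ * ∑ xs (λ x → ⌊ _≈ᵇ_ DX x (ψ y) ⌋))
        ≡⟨ ∑-cong ys (λ y → sym (∑-*ˡ xs ⌊ Q y ⌋ _)) ⟩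
      ∑ ys (λ y → ∑ xs (λ x → ⌊ Q y ⌋ * ⌊ _≈ᵇ_ DX x (ψ y) ⌋))
        ≡⟨ ∑-comm ys xs _ ⟩
      ∑ xs (λ x → ∑ ys (λ y → ⌊ Q y ⌋ * ⌊ _≈ᵇ_ DX x (ψ y) ⌋))
        ≡⟨ ∑-cong xs fibre-size ⟩
      ∑ xs (λ x → ⌊ P x ⌋) ∎
    where
    open ≡-Reasoning
    fibre-size : ∀ x → ∑ ys (λ y → ⌊ Q y ⌋ * ⌊ _≈ᵇ_ DX x (ψ y) ⌋) ≡ ⌊ P x ⌋
    fibre-size x with P x in Px
    ... | true with ψ-onto x (≡true⇒T Px)
    ...   | y₀ , Qy₀ , ψy₀≈x = trans (∑-cong ys in-fibre) (enumY y₀)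
      where
      in-fibre : ∀ y → ⌊ Q y ⌋ * ⌊ _≈ᵇ_ DX x (ψ y) ⌋ ≡ ⌊ _≈ᵇ_ DY y y₀ ⌋
      in-fibre y = trans (sym (⌊∧⌋ (Q y) _)) (cong ⌊_⌋ (T⇔T⇒≡ _ _
        (λ t → let (Qy , x≈ψy) = T-∧⁻ {Q y} t in
               T-does⁺ (y Y.≟ y₀) (ψ-inj y y₀ Qy Qy₀ (X.trans (X.sym (T-does⁻ (x X.≟ ψ y) x≈ψy)) (X.sym ψy₀≈x))))
        (λ t → let y≈y₀ = T-does⁻ (y Y.≟ y₀) t in
               T-∧⁺ {Q y} (≡true⇒T (trans (Q-resp y≈y₀) (T⇒≡true Qy₀)))
                          (T-does⁺ (x X.≟ ψ y) (X.trans (X.sym ψy₀≈x) (ψ-resp (Y.sym y≈y₀)))))))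
    fibre-size x | false = ∑-≡0 ys (λ y → trans (sym (⌊∧⌋ (Q y) _)) (⌊¬T⌋ (λ t →
        let (Qy , x≈ψy) = T-∧⁻ {Q y} t in
        subst T (trans (sym (P-resp (T-does⁻ (x X.≟ ψ y) x≈ψy))) Px) (ψ-into y Qy))))

finSetoid : ℕ → DecSetoid 0ℓ 0ℓ
finSetoid = Fin.≡-decSetoid

funSetoid : ℕ → DecSetoid 0ℓ 0ℓ → DecSetoid 0ℓ 0ℓ
funSetoid n D = FunPointwise.decSetoid D n

mapSetoid : ℕ → ℕ → DecSetoid 0ℓ 0ℓ
mapSetoid n m = funSetoid n (finSetoid m)

listSetoid : DecSetoid 0ℓ 0ℓ → DecSetoid 0ℓ 0ℓ
listSetoid = ListPointwise.decSetoid

allFin-enumerates : ∀ m → Enumerates (finSetoid m) (allFin m)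
allFin-enumerates (suc m) zero    =
  trans (∑-allFin-suc {m} (λ x → ⌊ does (x ≟ zero) ⌋)) (cong suc (∑-≡0 (allFin m) (λ _ → refl)))
allFin-enumerates (suc m) (suc y) =
  trans (∑-allFin-suc {m} (λ x → ⌊ does (x ≟ suc y) ⌋)) (trans (∑-cong (allFin m) suc≟suc) (allFin-enumerates m y))
  where
  suc≟suc : ∀ x → ⌊ does (suc x ≟ suc y) ⌋ ≡ ⌊ does (x ≟ y) ⌋
  suc≟suc x with x ≟ y
  ... | yes refl = refl
  ... | no _     = refl

allFunsOver : ∀ {A : Set} (n : ℕ) → List A → List (Fin n → A)
allFunsOver zero    xs = (λ ()) ∷ []
allFunsOver (suc n) xs = concatMap (λ f → map (λ a → a ∷ᶠ f) xs) (allFunsOver n xs)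

allFuns≡allFunsOver : ∀ n m → allFuns n m ≡ allFunsOver n (allFin m)
allFuns≡allFunsOver zero    m = refl
allFuns≡allFunsOver (suc n) m = cong (concatMap (λ f → map (λ a → a ∷ᶠ f) (allFin m))) (allFuns≡allFunsOver n m)

∑-allFunsOver-suc : ∀ {A : Set} n (xs : List A) (h : (Fin (suc n) → A) → ℕ) →
  ∑ (allFunsOver (suc n) xs) h ≡ ∑ (allFunsOver n xs) (λ f → ∑ xs (λ a → h (a ∷ᶠ f)))
∑-allFunsOver-suc n xs h = trans (∑-concatMap (allFunsOver n xs) _ h) (∑-cong (allFunsOver n xs) (λ f → ∑-map xs _ h))

listsOfLength : ∀ {A : Set} → ℕ → List A → List (List A)
listsOfLength zero    xs = [] ∷ []
listsOfLength (suc q) xs = concatMap (λ v → map (_∷ v) xs) (listsOfLength q xs)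

∑-listsOfLength-suc : ∀ {A : Set} q (xs : List A) (h : List A → ℕ) →
  ∑ (listsOfLength (suc q) xs) h ≡ ∑ (listsOfLength q xs) (λ v → ∑ xs (λ a → h (a ∷ v)))
∑-listsOfLength-suc q xs h = trans (∑-concatMap (listsOfLength q xs) _ h) (∑-cong (listsOfLength q xs) (λ v → ∑-map xs _ h))

∑-cartesianProduct : ∀ {A B : Set} (xs : List A) (ys : List B) (h : A × B → ℕ) →
  ∑ (cartesianProduct xs ys) h ≡ ∑ xs (λ a → ∑ ys (λ b → h (a , b)))
∑-cartesianProduct []       ys h = refl
∑-cartesianProduct (x ∷ xs) ys h =
  trans (∑-++ (map (x ,_) ys) _ h) (cong₂ _+_ (∑-map ys (x ,_) h) (∑-cartesianProduct xs ys h))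

-- Each enumeration lemma factors the indicator of a compound equality into a product of indicators.
module _ (D : DecSetoid 0ℓ 0ℓ) where
  open DecSetoid D using (Carrier) renaming (_≟_ to _≈?_)

  allFunsOver-enumerates : ∀ n (xs : List Carrier) → Enumerates D xs → Enumerates (funSetoid n D) (allFunsOver n xs)
  allFunsOver-enumerates zero    xs enum g = cong ⌊_⌋ (dec-true (DecSetoid._≟_ (funSetoid zero D) (λ ()) g) (λ ()))
  allFunsOver-enumerates (suc n) xs enum g = begin
      ∑ (allFunsOver (suc n) xs) (λ f → ⌊ _≈ᵇ_ (funSetoid (suc n) D) f g ⌋)
        ≡⟨ ∑-allFunsOver-suc n xs _ ⟩
      ∑ (allFunsOver n xs) (λ f → ∑ xs (λ a → ⌊ _≈ᵇ_ (funSetoid (suc n) D) (a ∷ᶠ f) g ⌋))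
        ≡⟨ ∑-cong (allFunsOver n xs) (λ f → trans (∑-cong xs (λ a → ⌊≈ᵇ∷ᶠ⌋ a f)) (∑-*ʳ xs _ _)) ⟩
      ∑ (allFunsOver n xs) (λ f → ∑ xs (λ a → ⌊ _≈ᵇ_ D a (g zero) ⌋) * ⌊ _≈ᵇ_ (funSetoid n D) f (g ∘ suc) ⌋)
        ≡⟨ ∑-cong (allFunsOver n xs) (λ f → trans (cong (_* _) (enum (g zero))) (*-identityˡ _)) ⟩
      ∑ (allFunsOver n xs) (λ f → ⌊ _≈ᵇ_ (funSetoid n D) f (g ∘ suc) ⌋)
        ≡⟨ allFunsOver-enumerates n xs enum (g ∘ suc) ⟩
      1 ∎
    where
    open ≡-Reasoning
    ⌊≈ᵇ∷ᶠ⌋ : ∀ a f → ⌊ _≈ᵇ_ (funSetoid (suc n) D) (a ∷ᶠ f) g ⌋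
                   ≡ ⌊ _≈ᵇ_ D a (g zero) ⌋ * ⌊ _≈ᵇ_ (funSetoid n D) f (g ∘ suc) ⌋
    ⌊≈ᵇ∷ᶠ⌋ a f = ⌊does⌋-× (a ≈? g zero) (DecSetoid._≟_ (funSetoid n D) f (g ∘ suc)) (DecSetoid._≟_ (funSetoid (suc n) D) (a ∷ᶠ f) g)
      (λ e → e zero , e ∘ suc) (λ { e₀ eₛ zero → e₀ ; e₀ eₛ (suc i) → eₛ i })

  listsOfLength-enumerates : ∀ q (xs : List Carrier) → Enumerates D xs →
                             EnumeratesOn (listSetoid D) (listsOfLength q xs) (λ v → length v ≡ q)
  listsOfLength-enumerates zero    xs enum []      refl = refl
  listsOfLength-enumerates (suc q) xs enum (b ∷ w) refl = begin
      ∑ (listsOfLength (suc q) xs) (λ v → ⌊ _≈ᵇ_ (listSetoid D) v (b ∷ w) ⌋)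
        ≡⟨ ∑-listsOfLength-suc q xs _ ⟩
      ∑ (listsOfLength q xs) (λ v → ∑ xs (λ a → ⌊ _≈ᵇ_ (listSetoid D) (a ∷ v) (b ∷ w) ⌋))
        ≡⟨ ∑-cong (listsOfLength q xs) (λ v → trans (∑-cong xs (λ a → ⌊≈ᵇ∷⌋ a v)) (∑-*ʳ xs _ _)) ⟩
      ∑ (listsOfLength q xs) (λ v → ∑ xs (λ a → ⌊ _≈ᵇ_ D a b ⌋) * ⌊ _≈ᵇ_ (listSetoid D) v w ⌋)
        ≡⟨ ∑-cong (listsOfLength q xs) (λ v → trans (cong (_* _) (enum b)) (*-identityˡ _)) ⟩
      ∑ (listsOfLength q xs) (λ v → ⌊ _≈ᵇ_ (listSetoid D) v w ⌋)
        ≡⟨ listsOfLength-enumerates q xs enum w refl ⟩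
      1 ∎
    where
    open ≡-Reasoning
    ⌊≈ᵇ∷⌋ : ∀ a v → ⌊ _≈ᵇ_ (listSetoid D) (a ∷ v) (b ∷ w) ⌋ ≡ ⌊ _≈ᵇ_ D a b ⌋ * ⌊ _≈ᵇ_ (listSetoid D) v w ⌋
    ⌊≈ᵇ∷⌋ a v = ⌊does⌋-× (a ≈? b) (DecSetoid._≟_ (listSetoid D) v w) (DecSetoid._≟_ (listSetoid D) (a ∷ v) (b ∷ w))
      (λ { (e ListPointwise.∷ es) → e , es }) ListPointwise._∷_

allFuns-enumerates : ∀ n m → Enumerates (mapSetoid n m) (allFuns n m)
allFuns-enumerates n m rewrite allFuns≡allFunsOver n m = allFunsOver-enumerates (finSetoid m) n (allFin m) (allFin-enumerates m)

cartesianProduct-enumerates : (D E : DecSetoid 0ℓ 0ℓ) (xs : List (DecSetoid.Carrier D)) (ys : List (DecSetoid.Carrier E)) →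
  Enumerates D xs → Enumerates E ys → Enumerates (×-decSetoid D E) (cartesianProduct xs ys)
cartesianProduct-enumerates D E xs ys enumD enumE (c , d) = begin
    ∑ (cartesianProduct xs ys) (λ z → ⌊ _≈ᵇ_ (×-decSetoid D E) z (c , d) ⌋)        ≡⟨ ∑-cartesianProduct xs ys _ ⟩
    ∑ xs (λ a → ∑ ys (λ b → ⌊ _≈ᵇ_ (×-decSetoid D E) (a , b) (c , d) ⌋))
      ≡⟨ ∑-cong xs (λ a → trans (∑-cong ys (λ b → ⌊≈ᵇ,⌋ a b)) (∑-*ˡ ys ⌊ _≈ᵇ_ D a c ⌋ _)) ⟩
    ∑ xs (λ a → ⌊ _≈ᵇ_ D a c ⌋ * ∑ ys (λ b → ⌊ _≈ᵇ_ E b d ⌋))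
      ≡⟨ ∑-cong xs (λ a → trans (cong (⌊ _≈ᵇ_ D a c ⌋ *_) (enumE d)) (*-identityʳ _)) ⟩
    ∑ xs (λ a → ⌊ _≈ᵇ_ D a c ⌋)                                                     ≡⟨ enumD c ⟩
    1                                                                               ∎
  where
  open ≡-Reasoning
  ⌊≈ᵇ,⌋ : ∀ a b → ⌊ _≈ᵇ_ (×-decSetoid D E) (a , b) (c , d) ⌋ ≡ ⌊ _≈ᵇ_ D a c ⌋ * ⌊ _≈ᵇ_ E b d ⌋
  ⌊≈ᵇ,⌋ a b = ⌊does⌋-× (DecSetoid._≟_ D a c) (DecSetoid._≟_ E b d) (DecSetoid._≟_ (×-decSetoid D E) (a , b) (c , d))
    id (λ x y → x , y)

module Congruence (p : ℕ) where

  -- Congruence mod p without subtraction, so that + and * respect it by semiring identities.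
  infix 4 _≋_
  _≋_ : ℕ → ℕ → Set
  a ≋ b = ∃₂ λ x y → a + x * p ≡ b + y * p

  ≋-refl : ∀ {a} → a ≋ a
  ≋-refl = 0 , 0 , refl

  ≡⇒≋ : ∀ {a b} → a ≡ b → a ≋ b
  ≡⇒≋ refl = ≋-refl

  ≋-sym : ∀ {a b} → a ≋ b → b ≋ a
  ≋-sym (x , y , e) = y , x , sym e

  ≋-trans : ∀ {a b c} → a ≋ b → b ≋ c → a ≋ c
  ≋-trans {a} {b} {c} (x , y , a≡b) (u , v , b≡c) = x + u , y + v , (begin
      a + (x + u) * p     ≡⟨ split-+ a x u p ⟩
      (a + x * p) + u * p ≡⟨ cong (_+ u * p) a≡b ⟩
      (b + y * p) + u * p ≡⟨ swap b y u p ⟩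
      (b + u * p) + y * p ≡⟨ cong (_+ y * p) b≡c ⟩
      (c + v * p) + y * p ≡⟨ swap-split c v y p ⟩
      c + (y + v) * p     ∎)
    where
    open ≡-Reasoning
    split-+ : ∀ a x u p → a + (x + u) * p ≡ (a + x * p) + u * p
    split-+ = solve-∀
    swap : ∀ b y u p → (b + y * p) + u * p ≡ (b + u * p) + y * p
    swap = solve-∀
    swap-split : ∀ c v y p → (c + v * p) + y * p ≡ c + (y + v) * p
    swap-split = solve-∀

  ≋-setoid : Setoid 0ℓ 0ℓ
  ≋-setoid = record { Carrier = ℕ ; _≈_ = _≋_ ; isEquivalence = record { refl = ≋-refl ; sym = ≋-sym ; trans = ≋-trans } }

  ≋-+-cong : ∀ {a b c d} → a ≋ b → c ≋ d → a + c ≋ b + d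
  ≋-+-cong {a} {b} {c} {d} (x , y , a≡b) (u , v , c≡d) = x + u , y + v , (begin
      a + c + (x + u) * p       ≡⟨ regroup a c x u p ⟩
      (a + x * p) + (c + u * p) ≡⟨ cong₂ _+_ a≡b c≡d ⟩
      (b + y * p) + (d + v * p) ≡⟨ sym (regroup b d y v p) ⟩
      b + d + (y + v) * p       ∎)
    where
    open ≡-Reasoning
    regroup : ∀ a c x u p → a + c + (x + u) * p ≡ (a + x * p) + (c + u * p)
    regroup = solve-∀

  ≋-*-cong : ∀ {a b c d} → a ≋ b → c ≋ d → a * c ≋ b * d
  ≋-*-cong {a} {b} {c} {d} (x , y , a≡b) (u , v , c≡d) =
    a * u + x * c + x * u * p , b * v + y * d + y * v * p , (begin
      a * c + (a * u + x * c + x * u * p) * p ≡⟨ expand a c x u p ⟩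
      (a + x * p) * (c + u * p)               ≡⟨ cong₂ _*_ a≡b c≡d ⟩
      (b + y * p) * (d + v * p)               ≡⟨ sym (expand b d y v p) ⟩
      b * d + (b * v + y * d + y * v * p) * p ∎)
    where
    open ≡-Reasoning
    expand : ∀ a c x u p → a * c + (a * u + x * c + x * u * p) * p ≡ (a + x * p) * (c + u * p)
    expand = solve-∀

  ≋-cancelʳ-+ : ∀ {a b} c → a + c ≋ b + c → a ≋ b
  ≋-cancelʳ-+ {a} {b} c (x , y , e) = x , y , +-cancelʳ-≡ c _ _ (begin
      a + x * p + c ≡⟨ +-comm-last a (x * p) c ⟩
      a + c + x * p ≡⟨ e ⟩
      b + c + y * p ≡⟨ sym (+-comm-last b (y * p) c) ⟩
      b + y * p + c ∎)
    where
    open ≡-Reasoning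
    +-comm-last : ∀ a b c → a + b + c ≡ a + c + b
    +-comm-last = solve-∀

  ≋-cancelˡ-+ : ∀ {a b} c → c + a ≋ c + b → a ≋ b
  ≋-cancelˡ-+ {a} {b} c e = ≋-cancelʳ-+ c (≋-trans (≡⇒≋ (+-comm a c)) (≋-trans e (≡⇒≋ (+-comm c b))))

  *p≋0 : ∀ x → x * p ≋ 0
  *p≋0 x = 0 , x , +-identityʳ (x * p)

  ∑-cong-≋ : ∀ {a} {A : Set a} (xs : List A) {f g : A → ℕ} → (∀ x → f x ≋ g x) → ∑ xs f ≋ ∑ xs g
  ∑-cong-≋ []       f≋g = ≋-refl
  ∑-cong-≋ (x ∷ xs) f≋g = ≋-+-cong (f≋g x) (∑-cong-≋ xs f≋g)

  ∣⇒≋0 : ∀ {a} → p ∣ a → a ≋ 0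
  ∣⇒≋0 (divides q refl) = *p≋0 q

  ≋0⇒∣ : ∀ {a} → a ≋ 0 → p ∣ a
  ≋0⇒∣ {a} (x , y , e) = divides (y ∸ x) (begin
      a                 ≡⟨ sym (m+n∸n≡m a (x * p)) ⟩
      a + x * p ∸ x * p ≡⟨ cong (_∸ x * p) e ⟩
      y * p ∸ x * p     ≡⟨ sym (*-distribʳ-∸ p y x) ⟩
      (y ∸ x) * p       ∎)
    where open ≡-Reasoning

  ≋⇒∣∸ : ∀ {a b} → a ≋ b → a ≤ b → p ∣ (b ∸ a)
  ≋⇒∣∸ {a} {b} a≋b a≤b = ≋0⇒∣ (≋-cancelˡ-+ a
    (≋-trans (≡⇒≋ (m+[n∸m]≡n a≤b)) (≋-trans (≋-sym a≋b) (≡⇒≋ (sym (+-identityʳ a))))))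

  ≋⇒≡[mod] : ∀ {a b} → a ≋ b → a ≡ b [mod p ]
  ≋⇒≡[mod] {a} {b} a≋b with ≤-total a b
  ... | inj₁ a≤b = subst (p ∣_) (trans (sym (m≤n⇒∣n-m∣≡n∸m a≤b)) (∣-∣-comm b a)) (≋⇒∣∸ a≋b a≤b)
  ... | inj₂ b≤a = subst (p ∣_) (sym (m≤n⇒∣n-m∣≡n∸m b≤a)) (≋⇒∣∸ (≋-sym a≋b) b≤a)

  module _ (p-prime : Prime p) where

    prime≡suc : ∃ λ q → p ≡ suc q
    prime≡suc = from-prime p-prime
      where
      from-prime : ∀ {n} → Prime n → ∃ λ q → n ≡ suc q
      from-prime {suc q} _ = q , refl

    ¬∣1 : ¬ (p ∣ 1)
    ¬∣1 p∣1 = ¬prime[1] (subst Prime (∣1⇒≡1 p∣1) p-prime)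

    ¬1≋0 : ¬ (1 ≋ 0)
    ¬1≋0 = ¬∣1 ∘ ≋0⇒∣

    ¬∣⇒coprime : ∀ {a} → ¬ p ∣ a → Coprime p a
    ¬∣⇒coprime ¬p∣a {i} (i∣p , i∣a) with prime⇒irreducible p-prime i∣p
    ... | inj₁ i≡1 = i≡1
    ... | inj₂ refl = ⊥-elim (¬p∣a i∣a)

    ≋-inverse : ∀ {a} → ¬ p ∣ a → ∃ λ b → a * b ≋ 1
    ≋-inverse {a} ¬p∣a with prime≡suc | coprime-Bézout (¬∣⇒coprime ¬p∣a)
    ... | q , p≡1+q | Bézout.+- x y 1+ya≡xp = y * q , x , a * y , (begin
        a * (y * q) + x * p       ≡⟨ cong (a * (y * q) +_) (sym 1+ya≡xp) ⟩
        a * (y * q) + (1 + y * a) ≡⟨ rearrange a y q ⟩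
        1 + a * y * suc q         ≡⟨ cong (λ z → 1 + a * y * z) (sym p≡1+q) ⟩
        1 + a * y * p             ∎)
      where
      open ≡-Reasoning
      rearrange : ∀ a y q → a * (y * q) + (1 + y * a) ≡ 1 + a * y * suc q
      rearrange = solve-∀
    ... | _ | Bézout.-+ x y ya≡1+xp = y , 0 , x , trans (+-identityʳ (a * y)) (trans (*-comm a y) (sym ya≡1+xp))

∑-downFrom-≡0 : ∀ n {f : ℕ → ℕ} → (∀ a → a < n → f a ≡ 0) → ∑ (downFrom n) f ≡ 0
∑-downFrom-≡0 zero    f≡0 = refl
∑-downFrom-≡0 (suc n) f≡0 = cong₂ _+_ (f≡0 n ≤-refl) (∑-downFrom-≡0 n (λ a a<n → f≡0 a (m≤n⇒m≤1+n a<n)))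

T-any-downFrom⁻ : ∀ n (f : ℕ → Bool) → T (any f (downFrom n)) → ∃ λ a → a < n × T (f a)
T-any-downFrom⁻ (suc n) f t with f n in fn
... | true  = n , ≤-refl , ≡true⇒T fn
... | false with T-any-downFrom⁻ n f t
...   | a , a<n , fa = a , m≤n⇒m≤1+n a<n , fa

T-any-downFrom⁺ : ∀ n (f : ℕ → Bool) a → a < n → T (f a) → T (any f (downFrom n))
T-any-downFrom⁺ (suc n) f a a<1+n fa with m<1+n⇒m<n∨m≡n a<1+n
... | inj₂ refl = Equivalence.from Bool.T-∨ (inj₁ fa)
... | inj₁ a<n  = Equivalence.from (Bool.T-∨ {f n}) (inj₂ (T-any-downFrom⁺ n f a a<n fa))

-- A map σ of prime order p splits an invariant set of σ-periodic points into orbits of size 1 or p,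
-- so the set and its σ-fixed points have the same size modulo p.
module OrbitCounting (D : DecSetoid 0ℓ 0ℓ) (p : ℕ) (p-prime : Prime p) (xs : List (DecSetoid.Carrier D))
                     (σ : DecSetoid.Carrier D → DecSetoid.Carrier D)
                     (σ-resp : σ Preserves DecSetoid._≈_ D ⟶ DecSetoid._≈_ D) where
  open DecSetoid D using (Carrier; _≈_) renaming
    (_≟_ to _≈?_; refl to ≈-refl; sym to ≈-sym; trans to ≈-trans; reflexive to ≈-reflexive; setoid to D-setoid)
  open Enumeration D using (≈ᵇ-respˡ; ∑-select)
  open Congruence p

  σ^ : ℕ → Carrier → Carrier
  σ^ zero    x = x
  σ^ (suc k) x = σ (σ^ k x)

  σ^-+ : ∀ a b x → σ^ (a + b) x ≡ σ^ a (σ^ b x)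
  σ^-+ zero    b x = refl
  σ^-+ (suc a) b x = cong σ (σ^-+ a b x)

  σ^-resp : ∀ k {x y} → x ≈ y → σ^ k x ≈ σ^ k y
  σ^-resp zero    x≈y = x≈y
  σ^-resp (suc k) x≈y = σ-resp (σ^-resp k x≈y)

  σ^-* : ∀ m t y → σ^ m y ≈ y → σ^ (t * m) y ≈ y
  σ^-* m zero    y _     = ≈-refl
  σ^-* m (suc t) y σ^m≈ = ≈-trans (≈-reflexive (σ^-+ m (t * m) y)) (≈-trans (σ^-resp m (σ^-* m t y σ^m≈)) σ^m≈)

  σ^p-periodic : ∀ x a → σ^ p x ≈ x → σ^ p (σ^ a x) ≈ σ^ a x
  σ^p-periodic x a σ^p≈ =
    ≈-trans (≈-reflexive (trans (sym (σ^-+ p a x)) (trans (cong (λ k → σ^ k x) (+-comm p a)) (σ^-+ a p x))))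
            (σ^-resp a σ^p≈)

  -- Bézout gives 1 + t·d = s·p or 1 + s·p = t·d; both powers on the right fix y.
  fixed-by-power⇒fixed : ∀ y d → σ^ p y ≈ y → 0 < d → d < p → σ^ d y ≈ y → σ y ≈ y
  fixed-by-power⇒fixed y d@(suc _) σ^p≈ 0<d d<p σ^d≈ with coprime-Bézout (prime⇒coprime p-prime d<p)
  ... | Bézout.+- x z 1+zd≡xp = begin
      σ y               ≈⟨ σ-resp (σ^-* d z y σ^d≈) ⟨
      σ^ (1 + z * d) y  ≡⟨ cong (λ k → σ^ k y) 1+zd≡xp ⟩
      σ^ (x * p) y      ≈⟨ σ^-* p x y σ^p≈ ⟩
      y                 ∎
    where open SetoidReasoning D-setoid
  ... | Bézout.-+ x z 1+xp≡zd = begin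
      σ y               ≈⟨ σ-resp (σ^-* p x y σ^p≈) ⟨
      σ^ (1 + x * p) y  ≡⟨ cong (λ k → σ^ k y) 1+xp≡zd ⟩
      σ^ (z * d) y      ≈⟨ σ^-* d z y σ^d≈ ⟩
      y                 ∎
    where open SetoidReasoning D-setoid

  fixes-σ^⇒fixes : ∀ x a → σ^ p x ≈ x → a < p → σ (σ^ a x) ≈ σ^ a x → σ x ≈ x
  fixes-σ^⇒fixes x a σ^p≈ a<p fixes = begin
      σ x                        ≈⟨ σ-resp σ^p≈ ⟨
      σ (σ^ p x)                 ≡⟨ cong (λ k → σ (σ^ k x)) (sym p∸a+a≡p) ⟩
      σ (σ^ (p ∸ a + a) x)       ≡⟨ cong σ (σ^-+ (p ∸ a) a x) ⟩
      σ^ (1 + (p ∸ a)) (σ^ a x)  ≡⟨ cong (λ k → σ^ k (σ^ a x)) (+-comm 1 (p ∸ a)) ⟩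
      σ^ (p ∸ a + 1) (σ^ a x)    ≡⟨ σ^-+ (p ∸ a) 1 (σ^ a x) ⟩
      σ^ (p ∸ a) (σ (σ^ a x))    ≈⟨ σ^-resp (p ∸ a) fixes ⟩
      σ^ (p ∸ a) (σ^ a x)        ≡⟨ sym (σ^-+ (p ∸ a) a x) ⟩
      σ^ (p ∸ a + a) x           ≡⟨ cong (λ k → σ^ k x) p∸a+a≡p ⟩
      σ^ p x                     ≈⟨ σ^p≈ ⟩
      x                          ∎
    where
    open SetoidReasoning D-setoid
    p∸a+a≡p = m∸n+n≡m (<⇒≤ a<p)

  orbit-repeats⇒fixed : ∀ x a b → σ^ p x ≈ x → a < b → b < p → σ^ a x ≈ σ^ b x → σ x ≈ x
  orbit-repeats⇒fixed x a b σ^p≈ a<b b<p σ^a≈σ^b = fixes-σ^⇒fixes x a σ^p≈ (<-trans a<b b<p)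
    (fixed-by-power⇒fixed (σ^ a x) (b ∸ a) (σ^p-periodic x a σ^p≈) (m<n⇒0<n∸m a<b) (≤-<-trans (m∸n≤m b a) b<p)
      (≈-trans (≈-reflexive (trans (sym (σ^-+ (b ∸ a) a x)) (cong (λ k → σ^ k x) (m∸n+n≡m (<⇒≤ a<b)))))
               (≈-sym σ^a≈σ^b)))

  isFixed : Carrier → Bool
  isFixed x = does (σ x ≈? x)

  record Invariant (P : Carrier → Bool) : Set where
    field
      P-resp       : P Preserves _≈_ ⟶ _≡_
      P-closed     : ∀ x → T (P x) → T (P (σ x))
      P-periodic   : ∀ x → T (P x) → σ^ p x ≈ x
      P-enumerated : EnumeratesOn D xs (T ∘ P)

    P-closed-σ^ : ∀ a x → T (P x) → T (P (σ^ a x))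
    P-closed-σ^ zero    x Px = Px
    P-closed-σ^ (suc a) x Px = P-closed _ (P-closed-σ^ a x Px)

  nonFixed-or-allFixed : ∀ (P : Carrier → Bool) ys →
    (∃ λ x → T (P x) × ¬ σ x ≈ x) ⊎ All (λ x → ⌊ P x ⌋ ≡ ⌊ P x ∧ isFixed x ⌋) ys
  nonFixed-or-allFixed P []       = inj₂ []
  nonFixed-or-allFixed P (x ∷ ys) with nonFixed-or-allFixed P ys
  ... | inj₁ w    = inj₁ w
  ... | inj₂ rest with σ x ≈? x
  ...   | yes fixed = inj₂ (⌊⌋≡⌊∧⌋ (λ _ → T-does⁺ (σ x ≈? x) fixed) ∷ rest)
  ...   | no ¬fixed with P x in Px
  ...     | true  = inj₁ (x , ≡true⇒T Px , ¬fixed)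
  ...     | false = inj₂ (⌊⌋≡⌊∧⌋ (λ t → ⊥-elim (subst T Px t)) ∷ rest)

  module RemoveOrbit (P : Carrier → Bool) (inv : Invariant P) (x₀ : Carrier) (Px₀ : T (P x₀)) (¬fixed : ¬ σ x₀ ≈ x₀) where
    open Invariant inv

    x₀-periodic : σ^ p x₀ ≈ x₀
    x₀-periodic = P-periodic x₀ Px₀

    inOrbit : Carrier → Bool
    inOrbit y = any (λ a → _≈ᵇ_ D y (σ^ a x₀)) (downFrom p)

    P∖orbit : Carrier → Bool
    P∖orbit y = P y ∧ not (inOrbit y)

    ⌊any⌋≡∑ : ∀ n → n ≤ p → ∀ y →
              ⌊ any (λ a → _≈ᵇ_ D y (σ^ a x₀)) (downFrom n) ⌋ ≡ ∑ (downFrom n) (λ a → ⌊ _≈ᵇ_ D y (σ^ a x₀) ⌋)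
    ⌊any⌋≡∑ zero    _     y = refl
    ⌊any⌋≡∑ (suc n) 1+n≤p y with y ≈? σ^ n x₀
    ... | no _       = ⌊any⌋≡∑ n (≤-trans (n≤1+n n) 1+n≤p) y
    ... | yes y≈σ^n = cong suc (sym (∑-downFrom-≡0 n earlier-miss))
      where
      earlier-miss : ∀ a → a < n → ⌊ _≈ᵇ_ D y (σ^ a x₀) ⌋ ≡ 0
      earlier-miss a a<n with y ≈? σ^ a x₀
      ... | no _       = refl
      ... | yes y≈σ^a = ⊥-elim (¬fixed (orbit-repeats⇒fixed x₀ a n x₀-periodic a<n 1+n≤p (≈-trans (≈-sym y≈σ^a) y≈σ^n)))

    orbit-size : ∑ xs (λ y → ⌊ P y ∧ inOrbit y ⌋) ≡ p
    orbit-size = begin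
        ∑ xs (λ y → ⌊ P y ∧ inOrbit y ⌋)
          ≡⟨ ∑-cong xs (λ y → ⌊∧⌋ (P y) (inOrbit y)) ⟩
        ∑ xs (λ y → ⌊ P y ⌋ * ⌊ inOrbit y ⌋)
          ≡⟨ ∑-cong xs (λ y → cong (⌊ P y ⌋ *_) (⌊any⌋≡∑ p ≤-refl y)) ⟩
        ∑ xs (λ y → ⌊ P y ⌋ * ∑ (downFrom p) (λ a → ⌊ _≈ᵇ_ D y (σ^ a x₀) ⌋))
          ≡⟨ ∑-cong xs (λ y → sym (∑-*ˡ (downFrom p) ⌊ P y ⌋ _)) ⟩
        ∑ xs (λ y → ∑ (downFrom p) (λ a → ⌊ P y ⌋ * ⌊ _≈ᵇ_ D y (σ^ a x₀) ⌋))
          ≡⟨ ∑-comm xs (downFrom p) _ ⟩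
        ∑ (downFrom p) (λ a → ∑ xs (λ y → ⌊ P y ⌋ * ⌊ _≈ᵇ_ D y (σ^ a x₀) ⌋))
          ≡⟨ ∑-cong (downFrom p) select ⟩
        ∑ (downFrom p) (λ _ → 1)
          ≡⟨ trans (∑-1≡length (downFrom p)) (length-downFrom p) ⟩
        p ∎
      where
      open ≡-Reasoning
      select : ∀ a → ∑ xs (λ y → ⌊ P y ⌋ * ⌊ _≈ᵇ_ D y (σ^ a x₀) ⌋) ≡ 1
      select a = trans (∑-cong xs (λ y → *-comm ⌊ P y ⌋ _))
                       (trans (∑-select xs (σ^ a x₀) (P-enumerated _ (P-closed-σ^ a x₀ Px₀)) (λ y → ⌊ P y ⌋) (cong ⌊_⌋ ∘ P-resp))
                              (⌊T⌋ (P-closed-σ^ a x₀ Px₀)))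

    ⌊P⌋-split : ∀ y → ⌊ P y ⌋ ≡ ⌊ P∖orbit y ⌋ + ⌊ P y ∧ inOrbit y ⌋
    ⌊P⌋-split y with P y | inOrbit y
    ... | true  | true  = refl
    ... | true  | false = refl
    ... | false | _     = refl

    fixed-outside-orbit : ∀ y → ⌊ P∖orbit y ∧ isFixed y ⌋ ≡ ⌊ P y ∧ isFixed y ⌋
    fixed-outside-orbit y with P y | σ y ≈? y | inOrbit y in y∈orbit
    ... | false | _          | _     = refl
    ... | true  | no _       | false = refl
    ... | true  | no _       | true  = refl
    ... | true  | yes _      | false = refl
    ... | true  | yes fixed  | true with T-any-downFrom⁻ p _ (≡true⇒T y∈orbit)
    ...   | a , a<p , y≈σ^a = ⊥-elim (¬fixed (fixes-σ^⇒fixes x₀ a x₀-periodic a<p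
              (≈-trans (σ-resp (≈-sym y≈σ^a′)) (≈-trans fixed y≈σ^a′))))
      where y≈σ^a′ = T-does⁻ (y ≈? σ^ a x₀) y≈σ^a

    inOrbit-resp : inOrbit Preserves _≈_ ⟶ _≡_
    inOrbit-resp {y} {y'} y≈y' = go p
      where
      go : ∀ n → any (λ a → _≈ᵇ_ D y (σ^ a x₀)) (downFrom n) ≡ any (λ a → _≈ᵇ_ D y' (σ^ a x₀)) (downFrom n)
      go zero    = refl
      go (suc n) = cong₂ _∨_ (≈ᵇ-respˡ (σ^ n x₀) y≈y') (go n)

    inOrbit-σ⁻ : ∀ y → T (P y) → T (inOrbit (σ y)) → T (inOrbit y)
    inOrbit-σ⁻ y Py σy∈orbit with T-any-downFrom⁻ p _ σy∈orbit | prime≡suc p-prime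
    ... | a , a<p , σy≈σ^a | q , p≡1+q = go a a<p (T-does⁻ (σ y ≈? σ^ a x₀) σy≈σ^a)
      where
      σ^q-σy≈y : σ^ q (σ y) ≈ y
      σ^q-σy≈y = ≈-trans (≈-reflexive (trans (sym (σ^-+ q 1 y)) (cong (λ k → σ^ k y) (trans (+-comm q 1) (sym p≡1+q)))))
                         (P-periodic y Py)
      in-orbit : ∀ b → b < p → y ≈ σ^ b x₀ → T (inOrbit y)
      in-orbit b b<p y≈ = T-any-downFrom⁺ p _ b b<p (T-does⁺ (y ≈? σ^ b x₀) y≈)
      go : ∀ a → a < p → σ y ≈ σ^ a x₀ → T (inOrbit y)
      go zero     _   σy≈x₀ = in-orbit q (subst (q <_) (sym p≡1+q) ≤-refl) (≈-trans (≈-sym σ^q-σy≈y) (σ^-resp q σy≈x₀))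
      go (suc a') a<p σy≈ = in-orbit a' (<-trans (n<1+n a') a<p) (begin
          y                         ≈⟨ σ^q-σy≈y ⟨
          σ^ q (σ y)
            ≈⟨ σ^-resp q σy≈ ⟩
          σ^ q (σ^ (suc a') x₀)
            ≡⟨ sym (σ^-+ q (suc a') x₀) ⟩
          σ^ (q + suc a') x₀
            ≡⟨ cong (λ k → σ^ k x₀) (trans (+-suc q a') (trans (+-comm (suc q) a') (cong (a' +_) (sym p≡1+q)))) ⟩
          σ^ (a' + p) x₀
            ≡⟨ σ^-+ a' p x₀ ⟩
          σ^ a' (σ^ p x₀)
            ≈⟨ σ^-resp a' x₀-periodic ⟩
          σ^ a' x₀ ∎)
        where open SetoidReasoning D-setoid

    P∖orbit-invariant : Invariant P∖orbit
    P∖orbit-invariant = record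
      { P-resp       = λ y≈y' → cong₂ (λ a b → a ∧ not b) (P-resp y≈y') (inOrbit-resp y≈y')
      ; P-closed     = closed
      ; P-periodic   = λ y t → P-periodic y (proj₁ (T-∧⁻ {P y} t))
      ; P-enumerated = λ y t → P-enumerated y (proj₁ (T-∧⁻ {P y} t))
      }
      where
      closed : ∀ y → T (P∖orbit y) → T (P∖orbit (σ y))
      closed y t with P y in Py | inOrbit y in y∈orbit
      ... | true | false with P (σ y) in Pσy | inOrbit (σ y) in σy∈orbit
      ...   | true  | false = tt
      ...   | false | _     = subst T Pσy (P-closed y (≡true⇒T Py))
      ...   | true  | true  = subst T y∈orbit (inOrbit-σ⁻ y (≡true⇒T Py) (≡true⇒T σy∈orbit))

  count≋count-fixed : ∀ n (P : Carrier → Bool) → Invariant P → ∑ xs (λ x → ⌊ P x ⌋) ≤ n →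
                      ∑ xs (λ x → ⌊ P x ⌋) ≋ ∑ xs (λ x → ⌊ P x ∧ isFixed x ⌋)
  count≋count-fixed n P inv bound with nonFixed-or-allFixed P xs
  ... | inj₂ allFixed = ≡⇒≋ (∑-cong-All xs allFixed)
  ... | inj₁ (x₀ , Px₀ , ¬fixed) = remove n (subst (_≤ n) count-split bound)
    where
    open RemoveOrbit P inv x₀ Px₀ ¬fixed
    rest = ∑ xs (λ x → ⌊ P∖orbit x ⌋)
    count-split : ∑ xs (λ x → ⌊ P x ⌋) ≡ rest + p
    count-split = trans (∑-cong xs ⌊P⌋-split) (trans (∑-+ xs _ _) (cong (rest +_) orbit-size))
    1≤p : 1 ≤ p
    1≤p = subst (1 ≤_) (sym (proj₂ (prime≡suc p-prime))) (s≤s z≤n)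
    remove : ∀ n → rest + p ≤ n → ∑ xs (λ x → ⌊ P x ⌋) ≋ ∑ xs (λ x → ⌊ P x ∧ isFixed x ⌋)
    remove zero    rest+p≤0 = ⊥-elim (1+n≰n (≤-trans (≤-trans 1≤p (m≤n+m p rest)) rest+p≤0))
    remove (suc n) rest+p≤1+n = begin
        ∑ xs (λ x → ⌊ P x ⌋)                   ≡⟨ count-split ⟩
        rest + p                              ≈⟨ ≋-+-cong (≋-refl {rest}) (≡⇒≋ (sym (*-identityˡ p))) ⟩
        rest + 1 * p                          ≈⟨ ≋-+-cong (≋-refl {rest}) (*p≋0 1) ⟩
        rest + 0                              ≡⟨ +-identityʳ rest ⟩
        rest                                  ≈⟨ count≋count-fixed n P∖orbit P∖orbit-invariant rest≤n ⟩
        ∑ xs (λ x → ⌊ P∖orbit x ∧ isFixed x ⌋) ≡⟨ ∑-cong xs fixed-outside-orbit ⟩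
        ∑ xs (λ x → ⌊ P x ∧ isFixed x ⌋)       ∎
      where
      open SetoidReasoning ≋-setoid
      rest≤n : rest ≤ n
      rest≤n = ≤-pred (subst (_≤ suc n) (+-comm rest 1) (≤-trans (+-monoʳ-≤ rest 1≤p) rest+p≤1+n))

V : Graph → Set
V G = Fin (size G)

module _ (G H : Graph) where

  IsHom : (V G → V H) → Set
  IsHom f = ∀ x y → T (adj G x y) → T (adj H (f x) (f y))

  IsVertexSurjective : (V G → V H) → Set
  IsVertexSurjective f = ∀ u → ∃ λ x → f x ≡ u

  IsEdgeSurjective : (V G → V H) → Set
  IsEdgeSurjective f = ∀ u v → T (adj H u v) → ∃₂ λ x y → T (adj G x y) × f x ≡ u × f y ≡ v

  IsSurjHom : (V G → V H) → Set
  IsSurjHom f = IsHom f × IsVertexSurjective f × IsEdgeSurjective f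

  isSurjHom : (V G → V H) → Bool
  isSurjHom f = isHom G H f ∧ isVertexSurj G H f ∧ isEdgeSurj G H f

  T-isHom⁻ : ∀ f → T (isHom G H f) → IsHom f
  T-isHom⁻ f t x y = T-⇒ᵇ⁻ (T-all⁻ _ (T-all⁻ _ t x) y)

  T-isHom⁺ : ∀ f → IsHom f → T (isHom G H f)
  T-isHom⁺ f f-hom = T-all⁺ _ (λ x → T-all⁺ _ (λ y → T-⇒ᵇ⁺ (f-hom x y)))

  T-isVertexSurj⁻ : ∀ f → T (isVertexSurj G H f) → IsVertexSurjective f
  T-isVertexSurj⁻ f t u = let (x , fx≟u) = T-anyFin⁻ _ (T-all⁻ _ t u) in x , T-does⁻ (f x ≟ u) fx≟u

  T-isVertexSurj⁺ : ∀ f → IsVertexSurjective f → T (isVertexSurj G H f)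
  T-isVertexSurj⁺ f onto = T-all⁺ _ (λ u → let (x , fx≡u) = onto u in T-anyFin⁺ _ x (T-does⁺ (f x ≟ u) fx≡u))

  T-isEdgeSurj⁻ : ∀ f → T (isEdgeSurj G H f) → IsEdgeSurjective f
  T-isEdgeSurj⁻ f t u v uv with T-anyFin⁻ _ (T-⇒ᵇ⁻ (T-all⁻ _ (T-all⁻ _ t u) v) uv)
  ... | x , t′ with T-anyFin⁻ _ t′
  ...   | y , t″ with T-∧⁻ {adj G x y} t″
  ...     | xy , t‴ with T-∧⁻ {does (f x ≟ u)} t‴
  ...       | fx≟u , fy≟v = x , y , xy , T-does⁻ (f x ≟ u) fx≟u , T-does⁻ (f y ≟ v) fy≟v

  T-isEdgeSurj⁺ : ∀ f → IsEdgeSurjective f → T (isEdgeSurj G H f)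
  T-isEdgeSurj⁺ f onto = T-all⁺ _ (λ u → T-all⁺ _ (λ v → T-⇒ᵇ⁺ (λ uv →
    let (x , y , xy , fx≡u , fy≡v) = onto u v uv in
    T-anyFin⁺ _ x (T-anyFin⁺ _ y (T-∧⁺ {adj G x y} xy (T-∧⁺ {does (f x ≟ u)} (T-does⁺ (f x ≟ u) fx≡u) (T-does⁺ (f y ≟ v) fy≡v)))))))

  T-isSurjHom⁻ : ∀ f → T (isSurjHom f) → IsSurjHom f
  T-isSurjHom⁻ f t = let (h , vs∧es) = T-∧⁻ {isHom G H f} t ; (vs , es) = T-∧⁻ {isVertexSurj G H f} vs∧es in
    T-isHom⁻ f h , T-isVertexSurj⁻ f vs , T-isEdgeSurj⁻ f es

  T-isSurjHom⁺ : ∀ f → IsSurjHom f → T (isSurjHom f)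
  T-isSurjHom⁺ f (h , vs , es) = T-∧⁺ {isHom G H f} (T-isHom⁺ f h) (T-∧⁺ {isVertexSurj G H f} (T-isVertexSurj⁺ f vs) (T-isEdgeSurj⁺ f es))

  hom≡∑ : hom G H ≡ ∑ (allFuns (size G) (size H)) (λ f → ⌊ isHom G H f ⌋)
  hom≡∑ = length-filter≡∑ (allFuns (size G) (size H)) (isHom G H)

  surj≡∑ : surj G H ≡ ∑ (allFuns (size G) (size H)) (λ f → ⌊ isSurjHom f ⌋)
  surj≡∑ = length-filter≡∑ (allFuns (size G) (size H)) isSurjHom

  private
    adj-cong : ∀ {u u' v v'} → u ≡ u' → v ≡ v' → T (adj H u v) → T (adj H u' v')
    adj-cong = subst₂ (λ u v → T (adj H u v))

  isHom-resp : isHom G H Preserves _≗_ ⟶ _≡_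
  isHom-resp {f} {g} f≗g = T⇔T⇒≡ _ _
    (λ t → T-isHom⁺ g (λ x y xy → adj-cong (f≗g x) (f≗g y) (T-isHom⁻ f t x y xy)))
    (λ t → T-isHom⁺ f (λ x y xy → adj-cong (sym (f≗g x)) (sym (f≗g y)) (T-isHom⁻ g t x y xy)))

  IsSurjHom-resp : ∀ {f g} → f ≗ g → IsSurjHom f → IsSurjHom g
  IsSurjHom-resp f≗g (h , vs , es) =
    (λ x y xy → adj-cong (f≗g x) (f≗g y) (h x y xy)) ,
    (λ u → let (x , fx≡u) = vs u in x , trans (sym (f≗g x)) fx≡u) ,
    (λ u v uv → let (x , y , xy , fx≡u , fy≡v) = es u v uv in x , y , xy , trans (sym (f≗g x)) fx≡u , trans (sym (f≗g y)) fy≡v)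

  isSurjHom-resp : isSurjHom Preserves _≗_ ⟶ _≡_
  isSurjHom-resp {f} {g} f≗g = T⇔T⇒≡ _ _
    (λ t → T-isSurjHom⁺ g (IsSurjHom-resp f≗g (T-isSurjHom⁻ f t)))
    (λ t → T-isSurjHom⁺ f (IsSurjHom-resp (sym ∘ f≗g) (T-isSurjHom⁻ g t)))

-- Counting maps between finite sets through their fibres.

fibre : ∀ {a b} (f : Fin a → Fin b) → Fin b → ℕ
fibre {a} f u = ∑ (allFin a) (λ x → ⌊ does (u ≟ f x) ⌋)

∑-fibre : ∀ {a b} (f : Fin a → Fin b) → ∑ (allFin b) (fibre f) ≡ a
∑-fibre {a} {b} f = begin
    ∑ (allFin b) (fibre f)
      ≡⟨ ∑-cong (allFin b) (λ u → ∑-cong (allFin a) (λ x → sym (*-identityʳ _))) ⟩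
    ∑ (allFin b) (λ u → ∑ (allFin a) (λ x → ⌊ does (u ≟ f x) ⌋ * 1))
      ≡⟨ ∑-partition (allFin a) (allFin b) f (λ _ → 1) (allFin-enumerates b) ⟨
    ∑ (allFin a) (λ _ → 1)
      ≡⟨ ∑-allFin-1 a ⟩
    a ∎
  where
  open ≡-Reasoning
  open Enumeration (finSetoid b) using (∑-partition)

fibre≥1 : ∀ {a b} (f : Fin a → Fin b) {u x} → f x ≡ u → 1 ≤ fibre f u
fibre≥1 f {u} {x} fx≡u = ≤-trans (≤-reflexive (sym (⌊T⌋ (T-does⁺ (u ≟ f x) (sym fx≡u))))) (∑-allFin-≥ _ (λ z → ⌊ does (u ≟ f z) ⌋) x)

surjective⇒≤ : ∀ {a b} (f : Fin a → Fin b) → (∀ u → ∃ λ x → f x ≡ u) → b ≤ a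
surjective⇒≤ f onto = injective⇒≤ (λ {u} {v} x≡ → trans (sym (proj₂ (onto u))) (trans (cong f x≡) (proj₂ (onto v))))

-- A surjection onto a set of the same size has all fibres of size 1.
surjective⇒injective : ∀ {n} (f : Fin n → Fin n) → (∀ u → ∃ λ x → f x ≡ u) → ∀ x y → f x ≡ f y → x ≡ y
surjective⇒injective {n} f onto x y fx≡fy with x ≟ y
... | yes x≡y = x≡y
... | no  x≢y = ⊥-elim (1+n≰n (≤-trans 2≤fibre (≤-reflexive fibre≡1)))
  where
  fibre≡1 : fibre f (f x) ≡ 1
  fibre≡1 = sym (∑-mono-≤-≡⇒≗ n (λ _ → 1) (fibre f) (λ u → fibre≥1 f (proj₂ (onto u)))
                              (trans (∑-allFin-1 n) (sym (∑-fibre f))) (f x))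
  x,y∈fibre : ∀ z → ⌊ does (z ≟ x) ⌋ + ⌊ does (z ≟ y) ⌋ ≤ ⌊ does (f x ≟ f z) ⌋
  x,y∈fibre z with z ≟ x | z ≟ y
  ... | yes refl | yes refl = ⊥-elim (x≢y refl)
  ... | yes refl | no _     = ≤-reflexive (sym (⌊T⌋ (T-does⁺ (f z ≟ f z) refl)))
  ... | no _     | yes refl = ≤-reflexive (sym (⌊T⌋ (T-does⁺ (f x ≟ f z) fx≡fy)))
  ... | no _     | no _     = z≤n
  2≤fibre : 2 ≤ fibre f (f x)
  2≤fibre = subst (_≤ fibre f (f x)) (trans (∑-+ (allFin n) _ _) (cong₂ _+_ (allFin-enumerates n x) (allFin-enumerates n y)))
                  (∑-mono-≤ (allFin n) x,y∈fibre)

∑-bijection : ∀ {a b} (f : Fin a → Fin b) (g : Fin b → Fin a) → (∀ x → g (f x) ≡ x) → (∀ u → f (g u) ≡ u) →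
              (h : Fin b → ℕ) → ∑ (allFin a) (h ∘ f) ≡ ∑ (allFin b) h
∑-bijection {a} {b} f g gf≗id fg≗id h = begin
    ∑ (allFin a) (h ∘ f)
      ≡⟨ ∑-partition (allFin a) (allFin b) f (h ∘ f) (allFin-enumerates b) ⟩
    ∑ (allFin b) (λ u → ∑ (allFin a) (λ x → ⌊ does (u ≟ f x) ⌋ * h (f x)))
      ≡⟨ ∑-cong (allFin b) (λ u → ∑-cong (allFin a) (fibre-is-g u)) ⟩
    ∑ (allFin b) (λ u → ∑ (allFin a) (λ x → ⌊ does (x ≟ g u) ⌋ * h u))
      ≡⟨ ∑-cong (allFin b) (λ u → trans (∑-*ʳ (allFin a) (h u) _) (trans (cong (_* h u) (allFin-enumerates a (g u))) (*-identityˡ (h u)))) ⟩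
    ∑ (allFin b) h ∎
  where
  open ≡-Reasoning
  open Enumeration (finSetoid b) using (∑-partition)
  fibre-is-g : ∀ u x → ⌊ does (u ≟ f x) ⌋ * h (f x) ≡ ⌊ does (x ≟ g u) ⌋ * h u
  fibre-is-g u x with u ≟ f x | x ≟ g u
  ... | yes refl | yes _    = refl
  ... | yes refl | no x≢gfx = ⊥-elim (x≢gfx (sym (gf≗id x)))
  ... | no u≢fgu | yes refl = ⊥-elim (u≢fgu (sym (fg≗id u)))
  ... | no _     | no _     = refl

Iso-sym : ∀ {G H} → Iso G H → Iso H G
Iso-sym {G} {H} (f , g , gf≗id , fg≗id , f-adj) =
  g , f , fg≗id , gf≗id , (λ x y → trans (sym (f-adj (g x) (g y))) (cong₂ (adj H) (fg≗id x) (fg≗id y)))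

Iso-trans : ∀ {G H K} → Iso G H → Iso H K → Iso G K
Iso-trans (f , g , gf≗id , fg≗id , f-adj) (f' , g' , g'f'≗id , f'g'≗id , f'-adj) =
  f' ∘ f , g ∘ g' ,
  (λ x → trans (cong g (g'f'≗id (f x))) (gf≗id x)) ,
  (λ z → trans (cong f' (fg≗id (g' z))) (f'g'≗id z)) ,
  (λ x y → trans (f'-adj (f x) (f y)) (f-adj x y))

IsSurjHom-∘-Iso : ∀ G {J H} (i : Iso J H) (g : V G → V J) → IsSurjHom G J g → IsSurjHom G H (proj₁ i ∘ g)
IsSurjHom-∘-Iso G {J} {H} (f , f⁻¹ , f⁻¹f≗id , ff⁻¹≗id , f-adj) g (g-hom , vs , es) =
  (λ x y xy → subst T (sym (f-adj (g x) (g y))) (g-hom x y xy)) ,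
  (λ u → let (x , gx≡) = vs (f⁻¹ u) in x , trans (cong f gx≡) (ff⁻¹≗id u)) ,
  (λ u v uv → let f⁻¹u-f⁻¹v = subst T (trans (cong₂ (adj H) (sym (ff⁻¹≗id u)) (sym (ff⁻¹≗id v))) (f-adj (f⁻¹ u) (f⁻¹ v))) uv
                  (x , y , xy , gx≡ , gy≡) = es (f⁻¹ u) (f⁻¹ v) f⁻¹u-f⁻¹v in
              x , y , xy , trans (cong f gx≡) (ff⁻¹≗id u) , trans (cong f gy≡) (ff⁻¹≗id v))

surj-respʳ-Iso : ∀ G {J H} → Iso J H → surj G J ≡ surj G H
surj-respʳ-Iso G {J} {H} i@(f , f⁻¹ , f⁻¹f≗id , ff⁻¹≗id , _) = begin
    surj G J
      ≡⟨ surj≡∑ G J ⟩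
    ∑ (allFuns (size G) (size J)) (λ g → ⌊ isSurjHom G J g ⌋)
      ≡⟨ count-bijection (mapSetoid (size G) (size H)) (mapSetoid (size G) (size J))
           (allFuns (size G) (size H)) (allFuns (size G) (size J)) (isSurjHom G H) (isSurjHom G J) (f ∘_)
           (allFuns-enumerates _ _) (allFuns-enumerates _ _) (isSurjHom-resp G H) (isSurjHom-resp G J)
           (λ g≗g' x → cong f (g≗g' x))
           (λ g t → T-isSurjHom⁺ G H (f ∘ g) (IsSurjHom-∘-Iso G {J} {H} i g (T-isSurjHom⁻ G J g t)))
           (λ g g' _ _ fg≗fg' x → trans (sym (f⁻¹f≗id (g x))) (trans (cong f⁻¹ (fg≗fg' x)) (f⁻¹f≗id (g' x))))
           (λ h t → f⁻¹ ∘ h , T-isSurjHom⁺ G J (f⁻¹ ∘ h) (IsSurjHom-∘-Iso G {H} {J} (Iso-sym {J} {H} i) h (T-isSurjHom⁻ G H h t)) ,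
                    (ff⁻¹≗id ∘ h)) ⟩
    ∑ (allFuns (size G) (size H)) (λ g → ⌊ isSurjHom G H g ⌋)
      ≡⟨ surj≡∑ G H ⟨
    surj G H ∎
  where open ≡-Reasoning

module _ (G H : Graph) (sameSize : size G ≡ size H) (f : V G → V H) (surjHom : IsSurjHom G H f) where

  IsSurjHom-injective : ∀ x y → f x ≡ f y → x ≡ y
  IsSurjHom-injective = injective sameSize f (proj₁ (proj₂ surjHom))
    where
    injective : ∀ {a b} → a ≡ b → (f : Fin a → Fin b) → (∀ u → ∃ λ x → f x ≡ u) → ∀ x y → f x ≡ f y → x ≡ y
    injective refl = surjective⇒injective

  IsSurjHom⇒Iso : Iso G H
  IsSurjHom⇒Iso = f , f⁻¹ , (λ x → IsSurjHom-injective _ x (proj₂ (vs (f x)))) , (λ u → proj₂ (vs u)) , f-adj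
    where
    f-hom = proj₁ surjHom
    vs    = proj₁ (proj₂ surjHom)
    es    = proj₂ (proj₂ surjHom)
    f⁻¹ : V H → V G
    f⁻¹ u = proj₁ (vs u)
    f-adj : ∀ x y → adj H (f x) (f y) ≡ adj G x y
    f-adj x y = T⇔T⇒≡ _ _ reflect (f-hom x y)
      where
      reflect : T (adj H (f x) (f y)) → T (adj G x y)
      reflect fxfy with es (f x) (f y) fxfy
      ... | x' , y' , x'y' , fx'≡ , fy'≡ =
        subst₂ (λ u v → T (adj G u v)) (IsSurjHom-injective x' x fx'≡) (IsSurjHom-injective y' y fy'≡) x'y'

-- σ g = ρ ∘ g has prime order on surjective homomorphisms G → J, and no fixed points
-- because ρ moves some vertex of J.
autOfOrder⇒p∣surj : ∀ p → Prime p → ∀ G J → AutOfOrder p J → p ∣ surj G J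
autOfOrder⇒p∣surj p p-prime G J (ρ , ρ-injective , ρ-adj , (x₀ , ρx₀≢x₀) , ρ^p≗id) =
  ≋0⇒∣ (≋-trans (≡⇒≋ (surj≡∑ G J)) (≋-trans (count≋count-fixed _ (isSurjHom G J) invariant ≤-refl) (≡⇒≋ no-fixed)))
  where
  open Congruence p
  maps = allFuns (size G) (size J)
  open OrbitCounting (mapSetoid (size G) (size J)) p p-prime maps (ρ ∘_) (λ g≗g' x → cong ρ (g≗g' x))
  q = proj₁ (prime≡suc p-prime)
  ρ⁻¹ : V J → V J
  ρ⁻¹ = iter q ρ
  ρρ⁻¹≗id : ∀ u → ρ (ρ⁻¹ u) ≡ u
  ρρ⁻¹≗id u = subst (λ k → iter k ρ u ≡ u) (proj₂ (prime≡suc p-prime)) (ρ^p≗id u)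
  ρ-Iso : Iso J J
  ρ-Iso = ρ , ρ⁻¹ , (λ u → ρ-injective (ρρ⁻¹≗id (ρ u))) , ρρ⁻¹≗id , ρ-adj
  σ^≗iter : ∀ k g x → σ^ k g x ≡ iter k ρ (g x)
  σ^≗iter zero    g x = refl
  σ^≗iter (suc k) g x = cong ρ (σ^≗iter k g x)
  invariant : Invariant (isSurjHom G J)
  invariant = record
    { P-resp       = isSurjHom-resp G J
    ; P-closed     = λ g t → T-isSurjHom⁺ G J (ρ ∘ g) (IsSurjHom-∘-Iso G {J} {J} ρ-Iso g (T-isSurjHom⁻ G J g t))
    ; P-periodic   = λ g _ x → trans (σ^≗iter p g x) (ρ^p≗id (g x))
    ; P-enumerated = λ g _ → allFuns-enumerates (size G) (size J) g
    }
  no-fixed : ∑ maps (λ g → ⌊ isSurjHom G J g ∧ isFixed g ⌋) ≡ 0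
  no-fixed = ∑-≡0 maps (λ g → ⌊¬T⌋ (λ t →
    let (surjective , fixed) = T-∧⁻ {isSurjHom G J g} t
        (y , gy≡x₀) = proj₁ (proj₂ (T-isSurjHom⁻ G J g surjective)) x₀
        ρg≗g = T-does⁻ (DecSetoid._≟_ (mapSetoid (size G) (size J)) (ρ ∘ g) g) fixed in
    ρx₀≢x₀ (trans (cong ρ (sym gy≡x₀)) (trans (ρg≗g y) gy≡x₀))))

IsSurjHom-id : ∀ G → IsSurjHom G G id
IsSurjHom-id G = (λ x y xy → xy) , (λ u → u , refl) , (λ u v uv → u , v , uv , refl , refl)

rotate : ∀ {A : Set} → List A → List A
rotate []       = []
rotate (a ∷ as) = as ++ (a ∷ [])

rotate-resp : ∀ {A : Set} {R : A → A → Set} {xs ys} → ListPointwise.Pointwise R xs ys → ListPointwise.Pointwise R (rotate xs) (rotate ys)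
rotate-resp ListPointwise.[]             = ListPointwise.[]
rotate-resp (x∼y ListPointwise.∷ xs∼ys) = ListPointwise.++⁺ xs∼ys (x∼y ListPointwise.∷ ListPointwise.[])

⌊∧⌋-regroup₁ : ∀ a b c d → ⌊ a ∧ ((c ∧ b) ∧ d) ⌋ ≡ ⌊ a ∧ b ⌋ * ⌊ c ∧ d ⌋
⌊∧⌋-regroup₁ false b     c     d     = refl
⌊∧⌋-regroup₁ true  false true  d     = refl
⌊∧⌋-regroup₁ true  false false d     = refl
⌊∧⌋-regroup₁ true  true  true  true  = refl
⌊∧⌋-regroup₁ true  true  true  false = refl
⌊∧⌋-regroup₁ true  true  false d     = refl

⌊∧⌋-regroup₂ : ∀ a b c → ⌊ a ∧ (c ∧ b) ⌋ ≡ ⌊ a ∧ b ⌋ * ⌊ c ⌋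
⌊∧⌋-regroup₂ false b     c     = refl
⌊∧⌋-regroup₂ true  true  true  = refl
⌊∧⌋-regroup₂ true  true  false = refl
⌊∧⌋-regroup₂ true  false true  = refl
⌊∧⌋-regroup₂ true  false false = refl

-- McKay's proof of Cauchy's theorem, for the automorphisms of F (its surjective endomorphisms):
-- the p-tuples of automorphisms composing to the identity number |Aut F|^(p-1), rotation permutes
-- them with prime order, and its only fixed tuple is (id, …, id) since F has no automorphism of order p.
-- Hence |Aut F|^(p-1) ≡ 1 (mod p).
module McKay (p : ℕ) (p-prime : Prime p) (F : Graph) (reduced : OrderReduced p F) where
  open Congruence p

  private
    n = size F
    Maps = mapSetoid n n
    Tuples = listSetoid Maps
    maps = allFuns n n
    q = proj₁ (prime≡suc p-prime)
    p≡1+q : p ≡ suc q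
    p≡1+q = proj₂ (prime≡suc p-prime)
    tuples = listsOfLength p maps
    _≈ₜ_ = DecSetoid._≈_ Tuples

  isAut : (V F → V F) → Bool
  isAut = isSurjHom F F

  Aut-injective : ∀ a → T (isAut a) → ∀ x y → a x ≡ a y → x ≡ y
  Aut-injective a t = IsSurjHom-injective F F refl a (T-isSurjHom⁻ F F a t)

  Aut-Iso : ∀ a → T (isAut a) → Iso F F
  Aut-Iso a t = IsSurjHom⇒Iso F F refl a (T-isSurjHom⁻ F F a t)

  compose : List (V F → V F) → V F → V F
  compose []       = id
  compose (a ∷ as) = a ∘ compose as

  compose-resp : ∀ {t t'} → t ≈ₜ t' → compose t ≗ compose t'
  compose-resp ListPointwise.[]                                x = refl
  compose-resp {a ∷ as} {b ∷ bs} (a≗b ListPointwise.∷ as≈bs) x = trans (cong a (compose-resp as≈bs x)) (a≗b (compose bs x))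

  compose-snoc : ∀ as a x → compose (as ++ (a ∷ [])) x ≡ compose as (a x)
  compose-snoc []       a x = refl
  compose-snoc (b ∷ as) a x = cong b (compose-snoc as a x)

  compose-replicate : ∀ k a x → compose (replicate k a) x ≡ iter k a x
  compose-replicate zero    a x = refl
  compose-replicate (suc k) a x = cong a (compose-replicate k a x)

  allAut : List (V F → V F) → Bool
  allAut = all isAut

  allAut⇒isAut-compose : ∀ t → T (allAut t) → IsSurjHom F F (compose t)
  allAut⇒isAut-compose []      _ = IsSurjHom-id F
  allAut⇒isAut-compose (a ∷ as) t = let (aut , auts) = T-∧⁻ {isAut a} t in
    IsSurjHom-∘-Iso F {F} {F} (Aut-Iso a aut) (compose as) (allAut⇒isAut-compose as auts)

  allAut-resp : allAut Preserves _≈ₜ_ ⟶ _≡_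
  allAut-resp ListPointwise.[]             = refl
  allAut-resp (a≗b ListPointwise.∷ as≈bs) = cong₂ _∧_ (isSurjHom-resp F F a≗b) (allAut-resp as≈bs)

  allAut-rotate : ∀ as a → T (allAut (a ∷ as)) → T (allAut (as ++ (a ∷ [])))
  allAut-rotate []       a t = t
  allAut-rotate (b ∷ as) a t = let (aut-a , rest) = T-∧⁻ {isAut a} t ; (aut-b , auts) = T-∧⁻ {isAut b} rest in
    T-∧⁺ {isAut b} aut-b (allAut-rotate as a (T-∧⁺ {isAut a} aut-a auts))

  isMcKay : List (V F → V F) → Bool
  isMcKay t = (length t ≡ᵇ p) ∧ allAut t ∧ _≈ᵇ_ Maps (compose t) id

  T-isMcKay⁻ : ∀ t → T (isMcKay t) → length t ≡ p × T (allAut t) × compose t ≗ id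
  T-isMcKay⁻ t mk = let (len , rest) = T-∧⁻ {length t ≡ᵇ p} mk ; (auts , closes) = T-∧⁻ {allAut t} rest in
    ≡ᵇ⇒≡ _ _ len , auts , T-does⁻ (DecSetoid._≟_ Maps (compose t) id) closes

  T-isMcKay⁺ : ∀ t → length t ≡ p → T (allAut t) → compose t ≗ id → T (isMcKay t)
  T-isMcKay⁺ t len auts closes =
    T-∧⁺ {length t ≡ᵇ p} (≡⇒≡ᵇ _ _ len) (T-∧⁺ {allAut t} auts (T-does⁺ (DecSetoid._≟_ Maps (compose t) id) closes))

  isMcKay-resp : isMcKay Preserves _≈ₜ_ ⟶ _≡_
  isMcKay-resp {t} {t'} t≈t' = T⇔T⇒≡ _ _
    (λ mk → let (len , auts , closes) = T-isMcKay⁻ t mk in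
      T-isMcKay⁺ t' (trans (sym (ListPointwise.Pointwise-length t≈t')) len) (subst T (allAut-resp t≈t') auts)
                 (λ x → trans (sym (compose-resp t≈t' x)) (closes x)))
    (λ mk → let (len , auts , closes) = T-isMcKay⁻ t' mk in
      T-isMcKay⁺ t (trans (ListPointwise.Pointwise-length t≈t') len) (subst T (sym (allAut-resp t≈t')) auts)
                 (λ x → trans (compose-resp t≈t' x) (closes x)))

  -- a₁ ∘ ⋯ ∘ aₚ = id forces a₂ ∘ ⋯ ∘ aₚ ∘ a₁ = id because a₁ is injective.
  isMcKay-rotate : ∀ t → T (isMcKay t) → T (isMcKay (rotate t))
  isMcKay-rotate [] mk = ⊥-elim (0≢1+n (trans (proj₁ (T-isMcKay⁻ [] mk)) p≡1+q))
  isMcKay-rotate (a ∷ as) mk with T-isMcKay⁻ (a ∷ as) mk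
  ... | len , auts , closes =
    T-isMcKay⁺ (as ++ (a ∷ [])) (trans (length-++ as) (trans (+-comm (length as) 1) len)) (allAut-rotate as a auts)
      (λ x → trans (compose-snoc as a x) (Aut-injective a (proj₁ (T-∧⁻ {isAut a} auts)) _ _ (closes (a x))))

  open OrbitCounting Tuples p p-prime tuples rotate rotate-resp

  rotate^length : ∀ xs ys → σ^ (length xs) (xs ++ ys) ≡ ys ++ xs
  rotate^length []       ys = sym (++-identityʳ ys)
  rotate^length (x ∷ xs) ys = begin
      σ^ (suc (length xs)) (x ∷ (xs ++ ys))
        ≡⟨ trans (cong (λ j → σ^ j (x ∷ (xs ++ ys))) (+-comm 1 (length xs))) (σ^-+ (length xs) 1 (x ∷ (xs ++ ys))) ⟩
      σ^ (length xs) ((xs ++ ys) ++ (x ∷ []))   ≡⟨ cong (σ^ (length xs)) (++-assoc xs ys (x ∷ [])) ⟩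
      σ^ (length xs) (xs ++ (ys ++ (x ∷ [])))   ≡⟨ rotate^length xs (ys ++ (x ∷ [])) ⟩
      (ys ++ (x ∷ [])) ++ xs                    ≡⟨ ++-assoc ys (x ∷ []) xs ⟩
      ys ++ (x ∷ xs)                            ∎
    where open ≡-Reasoning

  isMcKay-invariant : Invariant isMcKay
  isMcKay-invariant = record
    { P-resp       = isMcKay-resp
    ; P-closed     = isMcKay-rotate
    ; P-periodic   = λ t mk → DecSetoid.reflexive Tuples (rotate^p (proj₁ (T-isMcKay⁻ t mk)))
    ; P-enumerated = λ t mk → listsOfLength-enumerates Maps p maps (allFuns-enumerates n n) t (proj₁ (T-isMcKay⁻ t mk))
    }
    where
    rotate^p : ∀ {t} → length t ≡ p → σ^ p t ≡ t
    rotate^p {t} len = trans (cong (λ k → σ^ k t) (sym len)) (trans (cong (σ^ (length t)) (sym (++-identityʳ t))) (rotate^length t []))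

  identities : List (V F → V F)
  identities = replicate (suc q) id

  isMcKay-identities : T (isMcKay identities)
  isMcKay-identities = T-isMcKay⁺ identities (trans (length-replicate (suc q)) (sym p≡1+q)) (all-id (suc q))
    (λ x → trans (compose-replicate (suc q) id x) (iter-id (suc q) x))
    where
    all-id : ∀ k → T (allAut (replicate k id))
    all-id zero    = tt
    all-id (suc k) = T-∧⁺ {isAut id} (T-isSurjHom⁺ F F id (IsSurjHom-id F)) (all-id k)
    iter-id : ∀ k (x : V F) → iter k id x ≡ x
    iter-id zero    x = refl
    iter-id (suc k) x = iter-id k x

  rotation-fixed⇒constant : ∀ as a → (as ++ (a ∷ [])) ≈ₜ (a ∷ as) → as ≈ₜ replicate (length as) a
  rotation-fixed⇒constant []       a _ = ListPointwise.[]
  rotation-fixed⇒constant (b ∷ as) a (b≗a ListPointwise.∷ rest) =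
    b≗a ListPointwise.∷ rotation-fixed⇒constant as a (DecSetoid.trans Tuples rest (b≗a ListPointwise.∷ DecSetoid.refl Tuples))

  fixed⇒identities : ∀ t → T (isMcKay t ∧ isFixed t) → t ≈ₜ identities
  fixed⇒identities [] t = ⊥-elim (0≢1+n (trans (proj₁ (T-isMcKay⁻ [] (proj₁ (T-∧⁻ {isMcKay []} t)))) p≡1+q))
  fixed⇒identities (a ∷ as) t = DecSetoid.trans Tuples t≈aᵖ (replicate-resp a≗id)
    where
    mk = proj₁ (T-∧⁻ {isMcKay (a ∷ as)} t)
    fixed = T-does⁻ (DecSetoid._≟_ Tuples (rotate (a ∷ as)) (a ∷ as)) (proj₂ (T-∧⁻ {isMcKay (a ∷ as)} t))
    len = proj₁ (T-isMcKay⁻ (a ∷ as) mk)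
    aut-a = proj₁ (T-∧⁻ {isAut a} (proj₁ (proj₂ (T-isMcKay⁻ (a ∷ as) mk))))
    closes = proj₂ (proj₂ (T-isMcKay⁻ (a ∷ as) mk))
    t≈aᵖ : (a ∷ as) ≈ₜ replicate (suc q) a
    t≈aᵖ = DecSetoid.refl Maps ListPointwise.∷
           subst (λ k → as ≈ₜ replicate k a) (suc-injective (trans len p≡1+q)) (rotation-fixed⇒constant as a fixed)
    aᵖ≗id : ∀ x → iter p a x ≡ x
    aᵖ≗id x = subst (λ k → iter k a x ≡ x) (sym p≡1+q)
      (trans (sym (compose-replicate (suc q) a x)) (trans (sym (compose-resp t≈aᵖ x)) (closes x)))
    a≗id : a ≗ id
    a≗id with all? (λ x → a x ≟ x)
    ... | yes a≗id = a≗id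
    ... | no ¬a≗id = ⊥-elim (reduced (a , (λ {x} {y} → Aut-injective a aut-a x y) , proj₂ (proj₂ (proj₂ (proj₂ (Aut-Iso a aut-a)))) ,
                                       ¬∀⟶∃¬ n (λ x → a x ≡ x) (λ x → a x ≟ x) ¬a≗id , aᵖ≗id))
    replicate-resp : ∀ {a b} → a ≗ b → ∀ {k} → replicate k a ≈ₜ replicate k b
    replicate-resp a≗b {zero}  = ListPointwise.[]
    replicate-resp a≗b {suc k} = a≗b ListPointwise.∷ replicate-resp a≗b

  count-fixed : ∑ tuples (λ t → ⌊ isMcKay t ∧ isFixed t ⌋) ≡ 1
  count-fixed = trans (∑-cong tuples fixed≡identities) (Invariant.P-enumerated isMcKay-invariant identities isMcKay-identities)
    where
    fixed≡identities : ∀ t → ⌊ isMcKay t ∧ isFixed t ⌋ ≡ ⌊ _≈ᵇ_ Tuples t identities ⌋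
    fixed≡identities t = cong ⌊_⌋ (T⇔T⇒≡ _ _
      (T-does⁺ (DecSetoid._≟_ Tuples t identities) ∘ fixed⇒identities t)
      (λ u → let t≈ids = T-does⁻ (DecSetoid._≟_ Tuples t identities) u in
        T-∧⁺ {isMcKay t} (subst T (isMcKay-resp (DecSetoid.sym Tuples t≈ids)) isMcKay-identities)
          (T-does⁺ (DecSetoid._≟_ Tuples (rotate t) t)
            (DecSetoid.trans Tuples (rotate-resp t≈ids) (subst (_≈ₜ t) (sym (rotate-identities q)) (DecSetoid.sym Tuples t≈ids))))))
      where
      rotate-identities : ∀ k → rotate (replicate (suc k) id) ≡ replicate (suc k) id
      rotate-identities zero    = refl
      rotate-identities (suc k) = cong (id ∷_) (rotate-identities k)

  autCount : ℕ
  autCount = ∑ maps (λ a → ⌊ isAut a ⌋)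

  unique-left-inverse : ∀ h → IsSurjHom F F h → ∑ maps (λ a → ⌊ isAut a ∧ _≈ᵇ_ Maps (a ∘ h) id ⌋) ≡ 1
  unique-left-inverse h surj-h = trans (∑-cong maps is-h⁻¹) (allFuns-enumerates n n h⁻¹)
    where
    h-Iso = IsSurjHom⇒Iso F F refl h surj-h
    h⁻¹ = proj₁ (proj₂ h-Iso)
    h⁻¹h≗id = proj₁ (proj₂ (proj₂ h-Iso))
    hh⁻¹≗id = proj₁ (proj₂ (proj₂ (proj₂ h-Iso)))
    is-h⁻¹ : ∀ a → ⌊ isAut a ∧ _≈ᵇ_ Maps (a ∘ h) id ⌋ ≡ ⌊ _≈ᵇ_ Maps a h⁻¹ ⌋
    is-h⁻¹ a = cong ⌊_⌋ (T⇔T⇒≡ _ _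
      (λ t → let ah≗id = T-does⁻ (DecSetoid._≟_ Maps (a ∘ h) id) (proj₂ (T-∧⁻ {isAut a} t)) in
        T-does⁺ (DecSetoid._≟_ Maps a h⁻¹) (λ x → trans (cong a (sym (hh⁻¹≗id x))) (ah≗id (h⁻¹ x))))
      (λ t → let a≗h⁻¹ = T-does⁻ (DecSetoid._≟_ Maps a h⁻¹) t in
        T-∧⁺ {isAut a} (subst T (isSurjHom-resp F F (sym ∘ a≗h⁻¹))
                                (T-isSurjHom⁺ F F h⁻¹ (IsSurjHom-∘-Iso F {F} {F} (Iso-sym {F} {F} h-Iso) id (IsSurjHom-id F))))
                       (T-does⁺ (DecSetoid._≟_ Maps (a ∘ h) id) (λ x → trans (a≗h⁻¹ (h x)) (h⁻¹h≗id x)))))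

  count-automorphism-lists : ∀ k → ∑ (listsOfLength k maps) (λ v → ⌊ (length v ≡ᵇ k) ∧ allAut v ⌋) ≡ autCount ^ k
  count-automorphism-lists zero    = refl
  count-automorphism-lists (suc k) = begin
      ∑ (listsOfLength (suc k) maps) (λ v → ⌊ (length v ≡ᵇ suc k) ∧ allAut v ⌋)
        ≡⟨ ∑-listsOfLength-suc k maps _ ⟩
      ∑ (listsOfLength k maps) (λ v → ∑ maps (λ a → ⌊ (length v ≡ᵇ k) ∧ (isAut a ∧ allAut v) ⌋))
        ≡⟨ ∑-cong (listsOfLength k maps) (λ v → trans (∑-cong maps (λ a → ⌊∧⌋-regroup₂ (length v ≡ᵇ k) (allAut v) (isAut a)))
                                                    (∑-*ˡ maps ⌊ (length v ≡ᵇ k) ∧ allAut v ⌋ (λ a → ⌊ isAut a ⌋))) ⟩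
      ∑ (listsOfLength k maps) (λ v → ⌊ (length v ≡ᵇ k) ∧ allAut v ⌋ * autCount)
        ≡⟨ ∑-*ʳ (listsOfLength k maps) autCount _ ⟩
      ∑ (listsOfLength k maps) (λ v → ⌊ (length v ≡ᵇ k) ∧ allAut v ⌋) * autCount
        ≡⟨ cong (_* autCount) (count-automorphism-lists k) ⟩
      autCount ^ k * autCount
        ≡⟨ *-comm (autCount ^ k) autCount ⟩
      autCount ^ suc k ∎
    where open ≡-Reasoning

  -- The last entry of a McKay tuple is determined by the others.
  count-McKay : ∑ tuples (λ t → ⌊ isMcKay t ⌋) ≡ autCount ^ q
  count-McKay = begin
      ∑ tuples (λ t → ⌊ isMcKay t ⌋)
        ≡⟨ cong (λ k → ∑ (listsOfLength k maps) (λ t → ⌊ isMcKay t ⌋)) p≡1+q ⟩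
      ∑ (listsOfLength (suc q) maps) (λ t → ⌊ isMcKay t ⌋)
        ≡⟨ ∑-listsOfLength-suc q maps _ ⟩
      ∑ (listsOfLength q maps) (λ v → ∑ maps (λ a → ⌊ isMcKay (a ∷ v) ⌋))
        ≡⟨ ∑-cong (listsOfLength q maps) last-entry ⟩
      ∑ (listsOfLength q maps) (λ v → ⌊ (length v ≡ᵇ q) ∧ allAut v ⌋)
        ≡⟨ count-automorphism-lists q ⟩
      autCount ^ q ∎
    where
    open ≡-Reasoning
    last-entry : ∀ v → ∑ maps (λ a → ⌊ isMcKay (a ∷ v) ⌋) ≡ ⌊ (length v ≡ᵇ q) ∧ allAut v ⌋
    last-entry v = begin
        ∑ maps (λ a → ⌊ isMcKay (a ∷ v) ⌋)
          ≡⟨ ∑-cong maps (λ a → trans (cong (λ z → ⌊ z ∧ ((isAut a ∧ allAut v) ∧ _≈ᵇ_ Maps (a ∘ compose v) id) ⌋)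
                                            (cong (suc (length v) ≡ᵇ_) p≡1+q))
                                      (⌊∧⌋-regroup₁ (length v ≡ᵇ q) (allAut v) (isAut a) (_≈ᵇ_ Maps (a ∘ compose v) id))) ⟩
        ∑ maps (λ a → ⌊ (length v ≡ᵇ q) ∧ allAut v ⌋ * ⌊ isAut a ∧ _≈ᵇ_ Maps (a ∘ compose v) id ⌋)
          ≡⟨ ∑-*ˡ maps ⌊ (length v ≡ᵇ q) ∧ allAut v ⌋ _ ⟩
        ⌊ (length v ≡ᵇ q) ∧ allAut v ⌋ * ∑ maps (λ a → ⌊ isAut a ∧ _≈ᵇ_ Maps (a ∘ compose v) id ⌋)
          ≡⟨ factor _ _ (λ t → unique-left-inverse (compose v) (allAut⇒isAut-compose v (proj₂ (T-∧⁻ {length v ≡ᵇ q} t)))) ⟩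
        ⌊ (length v ≡ᵇ q) ∧ allAut v ⌋ ∎
      where
      factor : ∀ b m → (T b → m ≡ 1) → ⌊ b ⌋ * m ≡ ⌊ b ⌋
      factor true  m m≡1 = trans (+-identityʳ m) (m≡1 tt)
      factor false m _   = refl

  p∤surj : ¬ (p ∣ surj F F)
  p∤surj p∣surj = ¬1≋0 p-prime (≋-trans (≋-sym McKay≋1) (≋-trans (≡⇒≋ count-McKay) (∣⇒≋0 p∣autCount^q)))
    where
    McKay≋1 : ∑ tuples (λ t → ⌊ isMcKay t ⌋) ≋ 1
    McKay≋1 = ≋-trans (count≋count-fixed _ isMcKay isMcKay-invariant ≤-refl) (≡⇒≋ count-fixed)
    q≡1+q' : ∃ λ q' → q ≡ suc q'
    q≡1+q' with q | p≡1+q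
    ... | zero   | p≡1 = ⊥-elim (¬prime[1] (subst Prime p≡1 p-prime))
    ... | suc q' | _   = q' , refl
    p∣autCount^q : p ∣ autCount ^ q
    p∣autCount^q = subst (λ k → p ∣ autCount ^ k) (sym (proj₂ q≡1+q'))
                         (∣m⇒∣m*n (autCount ^ proj₁ q≡1+q') (subst (p ∣_) (surj≡∑ F F) p∣surj))

-- Subsets of Fin n, and the order-preserving bijection from Fin (card U) onto U.

suc-if : Bool → ℕ → ℕ
suc-if true  m = suc m
suc-if false m = m

card : ∀ {n} → (Fin n → Bool) → ℕ
card {zero}  U = 0
card {suc n} U = suc-if (U zero) (card (U ∘ suc))

embed-step : ∀ {n} b (m : ℕ) → (Fin m → Fin n) → Fin (suc-if b m) → Fin (suc n)
embed-step true  m e zero    = zero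
embed-step true  m e (suc a) = suc (e a)
embed-step false m e a       = suc (e a)

embed : ∀ {n} (U : Fin n → Bool) → Fin (card U) → Fin n
embed {suc n} U = embed-step (U zero) (card (U ∘ suc)) (embed (U ∘ suc))

embed-∈ : ∀ {n} (U : Fin n → Bool) a → T (U (embed U a))
embed-∈ {suc n} U a = go (U zero) refl a
  where
  go : ∀ b → U zero ≡ b → (a : Fin (suc-if b (card (U ∘ suc)))) → T (U (embed-step b (card (U ∘ suc)) (embed (U ∘ suc)) a))
  go true  U0 zero    = ≡true⇒T U0
  go true  U0 (suc a) = embed-∈ (U ∘ suc) a
  go false U0 a       = embed-∈ (U ∘ suc) a

embed-injective : ∀ {n} (U : Fin n → Bool) a a' → embed U a ≡ embed U a' → a ≡ a'
embed-injective {suc n} U = step (U zero) (embed-injective (U ∘ suc))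
  where
  step : ∀ b → (∀ a a' → embed (U ∘ suc) a ≡ embed (U ∘ suc) a' → a ≡ a') →
         ∀ a a' → embed-step b _ (embed (U ∘ suc)) a ≡ embed-step b _ (embed (U ∘ suc)) a' → a ≡ a'
  step true  inj zero    zero     _ = refl
  step true  inj (suc a) (suc a') e = cong suc (inj a a' (fin-suc-injective e))
  step false inj a       a'       e = inj a a' (fin-suc-injective e)

embed-onto : ∀ {n} (U : Fin n → Bool) u → T (U u) → ∃ λ a → embed U a ≡ u
embed-onto {suc n} U u Uu = go (U zero) refl u Uu
  where
  go : ∀ b → U zero ≡ b → ∀ u → T (U u) → ∃ λ (a : Fin (suc-if b (card (U ∘ suc)))) → embed-step b _ (embed (U ∘ suc)) a ≡ u
  go true  _  zero    _  = zero , refl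
  go false U0 zero    Uu = ⊥-elim (subst T U0 Uu)
  go true  _  (suc u) Uu = let (a , e) = embed-onto (U ∘ suc) u Uu in suc a , cong suc e
  go false _  (suc u) Uu = let (a , e) = embed-onto (U ∘ suc) u Uu in a , cong suc e

∑-embed : ∀ {n} (U : Fin n → Bool) (h : Fin n → ℕ) → ∑ (allFin (card U)) (h ∘ embed U) ≡ ∑ (allFin n) (λ u → ⌊ U u ⌋ * h u)
∑-embed {zero}  U h = refl
∑-embed {suc n} U h = trans (go (U zero) refl) (sym (∑-allFin-suc (λ u → ⌊ U u ⌋ * h u)))
  where
  rest = ∑ (allFin n) (λ u → ⌊ U (suc u) ⌋ * h (suc u))
  go : ∀ b → U zero ≡ b → ∑ (allFin (suc-if b (card (U ∘ suc)))) (h ∘ embed-step b _ (embed (U ∘ suc))) ≡ ⌊ U zero ⌋ * h zero + rest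
  go true  U0 = begin
      ∑ (allFin (suc (card (U ∘ suc)))) (h ∘ embed-step true _ (embed (U ∘ suc)))
        ≡⟨ ∑-allFin-suc (h ∘ embed-step true _ (embed (U ∘ suc))) ⟩
      h zero + ∑ (allFin (card (U ∘ suc))) (h ∘ suc ∘ embed (U ∘ suc))
        ≡⟨ cong (h zero +_) (∑-embed (U ∘ suc) (h ∘ suc)) ⟩
      h zero + rest
        ≡⟨ cong (_+ rest) (trans (sym (+-identityʳ (h zero))) (cong (λ b → ⌊ b ⌋ * h zero) (sym U0))) ⟩
      ⌊ U zero ⌋ * h zero + rest ∎
    where open ≡-Reasoning
  go false U0 = trans (∑-embed (U ∘ suc) (h ∘ suc)) (cong (λ b → ⌊ b ⌋ * h zero + rest) (sym U0))

card≡∑ : ∀ {n} (U : Fin n → Bool) → card U ≡ ∑ (allFin n) (λ u → ⌊ U u ⌋)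
card≡∑ {n} U = trans (sym (∑-allFin-1 (card U))) (trans (∑-embed U (λ _ → 1)) (∑-cong (allFin n) (λ u → *-identityʳ _)))

-- A candidate subgraph: vertex set and edge relation; isSubgraphOf H checks that it is one.
Subgraph : ℕ → Set
Subgraph n = (Fin n → Bool) × (Fin n → Fin n → Bool)

subgraphSetoid : ℕ → DecSetoid 0ℓ 0ℓ
subgraphSetoid n = ×-decSetoid (funSetoid n Bool.≡-decSetoid) (funSetoid n (funSetoid n Bool.≡-decSetoid))

bools : List Bool
bools = true ∷ false ∷ []

bools-enumerates : Enumerates Bool.≡-decSetoid bools
bools-enumerates true  = refl
bools-enumerates false = refl

subgraphs : (n : ℕ) → List (Subgraph n)
subgraphs n = cartesianProduct (allFunsOver n bools) (allFunsOver n (allFunsOver n bools))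

subgraphs-enumerates : ∀ n → Enumerates (subgraphSetoid n) (subgraphs n)
subgraphs-enumerates n = cartesianProduct-enumerates (funSetoid n Bool.≡-decSetoid) (funSetoid n (funSetoid n Bool.≡-decSetoid))
  (allFunsOver n bools) (allFunsOver n (allFunsOver n bools)) vertexSets-enumerate
  (allFunsOver-enumerates (funSetoid n Bool.≡-decSetoid) n (allFunsOver n bools) vertexSets-enumerate)
  where
  vertexSets-enumerate : Enumerates (funSetoid n Bool.≡-decSetoid) (allFunsOver n bools)
  vertexSets-enumerate = allFunsOver-enumerates Bool.≡-decSetoid n bools bools-enumerates

toGraph : ∀ {n} → Subgraph n → Graph
toGraph (U , E) = record
  { size = card U
  ; adj  = λ a b → E (embed U a) (embed U b) ∧ E (embed U b) (embed U a)
  ; sym  = λ a b → Bool.∧-comm (E (embed U a) (embed U b)) _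
  }

module _ (H : Graph) where

  isSubgraphOf : Subgraph (size H) → Bool
  isSubgraphOf (U , E) = all (λ u → all (λ v → (E u v ⇒ᵇ (U u ∧ U v ∧ adj H u v)) ∧ (E u v ⇒ᵇ E v u)) (allFin _)) (allFin _)

  IsSubgraphOf : Subgraph (size H) → Set
  IsSubgraphOf (U , E) = ∀ u v → T (E u v) → T (U u) × T (U v) × T (adj H u v) × T (E v u)

  T-isSubgraphOf⁻ : ∀ s → T (isSubgraphOf s) → IsSubgraphOf s
  T-isSubgraphOf⁻ (U , E) t u v uv =
    let (inside , symmetric) = T-∧⁻ {E u v ⇒ᵇ _} (T-all⁻ _ (T-all⁻ _ t u) v)
        (Uu , Uv∧adj) = T-∧⁻ {U u} (T-⇒ᵇ⁻ inside uv) ; (Uv , adj-uv) = T-∧⁻ {U v} Uv∧adj in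
    Uu , Uv , adj-uv , T-⇒ᵇ⁻ symmetric uv

  T-isSubgraphOf⁺ : ∀ s → IsSubgraphOf s → T (isSubgraphOf s)
  T-isSubgraphOf⁺ (U , E) sub = T-all⁺ _ (λ u → T-all⁺ _ (λ v → T-∧⁺ {E u v ⇒ᵇ _}
    (T-⇒ᵇ⁺ (λ uv → let (Uu , Uv , adj-uv , _) = sub u v uv in T-∧⁺ {U u} Uu (T-∧⁺ {U v} Uv adj-uv)))
    (T-⇒ᵇ⁺ (λ uv → proj₂ (proj₂ (proj₂ (sub u v uv)))))))

  isSubgraphOf-resp : isSubgraphOf Preserves DecSetoid._≈_ (subgraphSetoid (size H)) ⟶ _≡_
  isSubgraphOf-resp {U , E} {U' , E'} (U≗U' , E≗E') = T⇔T⇒≡ _ _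
    (λ t → T-isSubgraphOf⁺ (U' , E') (λ u v uv → let (Uu , Uv , adj-uv , vu) = T-isSubgraphOf⁻ (U , E) t u v (subst T (sym (E≗E' u v)) uv) in
      subst T (U≗U' u) Uu , subst T (U≗U' v) Uv , adj-uv , subst T (E≗E' v u) vu))
    (λ t → T-isSubgraphOf⁺ (U , E) (λ u v uv → let (Uu , Uv , adj-uv , vu) = T-isSubgraphOf⁻ (U' , E') t u v (subst T (E≗E' u v) uv) in
      subst T (sym (U≗U' u)) Uu , subst T (sym (U≗U' v)) Uv , adj-uv , subst T (sym (E≗E' v u)) vu))

module _ (G H : Graph) where

  image : (V G → V H) → Subgraph (size H)
  image f = (λ u → any (λ x → does (f x ≟ u)) (allFin (size G))) ,
            (λ u v → any (λ x → any (λ y → adj G x y ∧ does (f x ≟ u) ∧ does (f y ≟ v)) (allFin (size G))) (allFin (size G)))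

  T-image-vertex⁻ : ∀ f u → T (proj₁ (image f) u) → ∃ λ x → f x ≡ u
  T-image-vertex⁻ f u t = let (x , fx≟u) = T-anyFin⁻ _ t in x , T-does⁻ (f x ≟ u) fx≟u

  T-image-vertex⁺ : ∀ f {u} x → f x ≡ u → T (proj₁ (image f) u)
  T-image-vertex⁺ f {u} x fx≡u = T-anyFin⁺ _ x (T-does⁺ (f x ≟ u) fx≡u)

  T-image-edge⁻ : ∀ f u v → T (proj₂ (image f) u v) → ∃₂ λ x y → T (adj G x y) × f x ≡ u × f y ≡ v
  T-image-edge⁻ f u v t =
    let (x , t′) = T-anyFin⁻ _ t ; (y , t″) = T-anyFin⁻ _ t′ ; (xy , t‴) = T-∧⁻ {adj G x y} t″
        (fx≟u , fy≟v) = T-∧⁻ {does (f x ≟ u)} t‴ in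
    x , y , xy , T-does⁻ (f x ≟ u) fx≟u , T-does⁻ (f y ≟ v) fy≟v

  T-image-edge⁺ : ∀ f {u v} x y → T (adj G x y) → f x ≡ u → f y ≡ v → T (proj₂ (image f) u v)
  T-image-edge⁺ f {u} {v} x y xy fx≡u fy≡v =
    T-anyFin⁺ _ x (T-anyFin⁺ _ y (T-∧⁺ {adj G x y} xy (T-∧⁺ {does (f x ≟ u)} (T-does⁺ (f x ≟ u) fx≡u) (T-does⁺ (f y ≟ v) fy≡v))))

  image-resp : image Preserves _≗_ ⟶ DecSetoid._≈_ (subgraphSetoid (size H))
  image-resp {f} {f'} f≗f' =
    (λ u → T⇔T⇒≡ _ _
      (λ t → let (x , fx≡u) = T-image-vertex⁻ f u t in T-image-vertex⁺ f' x (trans (sym (f≗f' x)) fx≡u))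
      (λ t → let (x , f'x≡u) = T-image-vertex⁻ f' u t in T-image-vertex⁺ f x (trans (f≗f' x) f'x≡u))) ,
    (λ u v → T⇔T⇒≡ _ _
      (λ t → let (x , y , xy , fx≡u , fy≡v) = T-image-edge⁻ f u v t in
             T-image-edge⁺ f' x y xy (trans (sym (f≗f' x)) fx≡u) (trans (sym (f≗f' y)) fy≡v))
      (λ t → let (x , y , xy , f'x≡u , f'y≡v) = T-image-edge⁻ f' u v t in
             T-image-edge⁺ f x y xy (trans (f≗f' x) f'x≡u) (trans (f≗f' y) f'y≡v)))

  image-isSubgraphOf : ∀ f → IsHom G H f → IsSubgraphOf H (image f)
  image-isSubgraphOf f f-hom u v t = let (x , y , xy , fx≡u , fy≡v) = T-image-edge⁻ f u v t in
    T-image-vertex⁺ f x fx≡u , T-image-vertex⁺ f y fy≡v , subst₂ (λ a b → T (adj H a b)) fx≡u fy≡v (f-hom x y xy) ,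
    T-image-edge⁺ f y x (subst T (adj-sym G x y) xy) fy≡v fx≡u

-- Every homomorphism G → H is a surjective homomorphism onto its image.
module HomDecomposition (G H : Graph) where
  private
    n = size H
    maps = allFuns (size G) n
    Subgraphs = subgraphSetoid n
    _≈ₛ_ = DecSetoid._≈_ Subgraphs
  open Enumeration Subgraphs using (≈ᵇ-respʳ; ∑-partition)

  hasImage : Subgraph n → (V G → V H) → Bool
  hasImage s f = isHom G H f ∧ _≈ᵇ_ Subgraphs s (image G H f)

  hasImage-resp : ∀ s → hasImage s Preserves _≗_ ⟶ _≡_
  hasImage-resp s f≗f' = cong₂ _∧_ (isHom-resp G H f≗f') (≈ᵇ-respʳ s (image-resp G H f≗f'))

  ∑-hasImage-nonSubgraph : ∀ s → ¬ T (isSubgraphOf H s) → ∑ maps (λ f → ⌊ hasImage s f ⌋) ≡ 0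
  ∑-hasImage-nonSubgraph s ¬sub = ∑-≡0 maps (λ f → ⌊¬T⌋ (λ t →
    let (f-hom , s≈im) = T-∧⁻ {isHom G H f} t in
    ¬sub (subst T (isSubgraphOf-resp H (DecSetoid.sym Subgraphs (T-does⁻ (DecSetoid._≟_ Subgraphs s (image G H f)) s≈im)))
                  (T-isSubgraphOf⁺ H (image G H f) (image-isSubgraphOf G H f (T-isHom⁻ G H f f-hom))))))

  module _ (U : Fin n → Bool) (E : Fin n → Fin n → Bool) (sub : IsSubgraphOf H (U , E)) where
    private
      s = (U , E)
      K = toGraph s
      E-cong : ∀ {u u' v v'} → u ≡ u' → v ≡ v' → T (E u v) → T (E u' v')
      E-cong = subst₂ (λ u v → T (E u v))

    embed-hasImage : ∀ g → IsSurjHom G K g → T (hasImage s (embed U ∘ g))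
    embed-hasImage g (g-hom , vs , es) =
      T-∧⁺ {isHom G H (embed U ∘ g)} (T-isHom⁺ G H _ f-hom) (T-does⁺ (DecSetoid._≟_ Subgraphs s (image G H f)) (same-vertices , same-edges))
      where
      f = embed U ∘ g
      f-hom : IsHom G H f
      f-hom x y xy = proj₁ (proj₂ (proj₂ (sub _ _ (proj₁ (T-∧⁻ {E (f x) (f y)} (g-hom x y xy))))))
      same-vertices : ∀ u → U u ≡ proj₁ (image G H f) u
      same-vertices u = T⇔T⇒≡ _ _
        (λ Uu → let (a , ea≡u) = embed-onto U u Uu ; (x , gx≡a) = vs a in T-image-vertex⁺ G H f x (trans (cong (embed U) gx≡a) ea≡u))
        (λ t → let (x , fx≡u) = T-image-vertex⁻ G H f u t in subst (T ∘ U) fx≡u (embed-∈ U (g x)))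
      same-edges : ∀ u v → E u v ≡ proj₂ (image G H f) u v
      same-edges u v = T⇔T⇒≡ _ _
        (λ uv → let (Uu , Uv , _ , vu) = sub u v uv
                    (a , ea≡u) = embed-onto U u Uu ; (b , eb≡v) = embed-onto U v Uv
                    (x , y , xy , gx≡a , gy≡b) = es a b (T-∧⁺ {E (embed U a) (embed U b)} (E-cong (sym ea≡u) (sym eb≡v) uv)
                                                                                           (E-cong (sym eb≡v) (sym ea≡u) vu)) in
                T-image-edge⁺ G H f x y xy (trans (cong (embed U) gx≡a) ea≡u) (trans (cong (embed U) gy≡b) eb≡v))
        (λ t → let (x , y , xy , fx≡u , fy≡v) = T-image-edge⁻ G H f u v t in
               E-cong fx≡u fy≡v (proj₁ (T-∧⁻ {E (f x) (f y)} (g-hom x y xy))))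

    corestriction : ∀ f → T (hasImage s f) → ∃ λ g → IsSurjHom G K g × embed U ∘ g ≗ f
    corestriction f t = g , (g-hom , vs , es) , embed∘g≗f
      where
      f-hom = T-isHom⁻ G H f (proj₁ (T-∧⁻ {isHom G H f} t))
      s≈im = T-does⁻ (DecSetoid._≟_ Subgraphs s (image G H f)) (proj₂ (T-∧⁻ {isHom G H f} t))
      U≡im = proj₁ s≈im
      E≡im = proj₂ s≈im
      f∈U : ∀ x → T (U (f x))
      f∈U x = subst T (sym (U≡im (f x))) (T-image-vertex⁺ G H f x refl)
      g : V G → V K
      g x = proj₁ (embed-onto U (f x) (f∈U x))
      embed∘g≗f : ∀ x → embed U (g x) ≡ f x
      embed∘g≗f x = proj₂ (embed-onto U (f x) (f∈U x))
      f-edges : ∀ x y → T (adj G x y) → T (E (f x) (f y))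
      f-edges x y xy = subst T (sym (E≡im (f x) (f y))) (T-image-edge⁺ G H f x y xy refl refl)
      g-hom : IsHom G K g
      g-hom x y xy = T-∧⁺ {E (embed U (g x)) (embed U (g y))}
        (E-cong (sym (embed∘g≗f x)) (sym (embed∘g≗f y)) (f-edges x y xy))
        (E-cong (sym (embed∘g≗f y)) (sym (embed∘g≗f x)) (f-edges y x (subst T (adj-sym G x y) xy)))
      vs : IsVertexSurjective G K g
      vs a = let (x , fx≡ea) = T-image-vertex⁻ G H f (embed U a) (subst T (U≡im (embed U a)) (embed-∈ U a)) in
             x , embed-injective U _ _ (trans (embed∘g≗f x) fx≡ea)
      es : IsEdgeSurjective G K g
      es a b ab = let (x , y , xy , fx≡ea , fy≡eb) = T-image-edge⁻ G H f (embed U a) (embed U b)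
                                                      (subst T (E≡im (embed U a) (embed U b)) (proj₁ (T-∧⁻ {E (embed U a) (embed U b)} ab))) in
        x , y , xy , embed-injective U _ _ (trans (embed∘g≗f x) fx≡ea) , embed-injective U _ _ (trans (embed∘g≗f y) fy≡eb)

    ∑-hasImage≡surj : ∑ maps (λ f → ⌊ hasImage s f ⌋) ≡ surj G K
    ∑-hasImage≡surj = sym (trans (surj≡∑ G K)
      (count-bijection (mapSetoid (size G) n) (mapSetoid (size G) (card U)) maps (allFuns (size G) (card U))
         (hasImage s) (isSurjHom G K) (embed U ∘_) (allFuns-enumerates _ _) (allFuns-enumerates _ _)
         (hasImage-resp s) (isSurjHom-resp G K) (λ g≗g' x → cong (embed U) (g≗g' x))
         (λ g t → embed-hasImage g (T-isSurjHom⁻ G K g t))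
         (λ g g' _ _ eg≗eg' x → embed-injective U _ _ (eg≗eg' x))
         (λ f t → let (g , g-surj , eg≗f) = corestriction f t in g , T-isSurjHom⁺ G K g g-surj , eg≗f)))

  ∑-hasImage : ∀ s → ∑ maps (λ f → ⌊ hasImage s f ⌋) ≡ ⌊ isSubgraphOf H s ⌋ * surj G (toGraph s)
  ∑-hasImage s@(U , E) with isSubgraphOf H s in sub
  ... | true  = trans (∑-hasImage≡surj U E (T-isSubgraphOf⁻ H s (≡true⇒T sub))) (sym (+-identityʳ _))
  ... | false = ∑-hasImage-nonSubgraph s (subst T sub)

  hom≡∑surj : hom G H ≡ ∑ (subgraphs n) (λ s → ⌊ isSubgraphOf H s ⌋ * surj G (toGraph s))
  hom≡∑surj = begin
      hom G H                                                                   ≡⟨ hom≡∑ G H ⟩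
      ∑ maps (λ f → ⌊ isHom G H f ⌋)
        ≡⟨ ∑-partition maps (subgraphs n) (image G H) _ (subgraphs-enumerates n) ⟩
      ∑ (subgraphs n) (λ s → ∑ maps (λ f → ⌊ _≈ᵇ_ Subgraphs s (image G H f) ⌋ * ⌊ isHom G H f ⌋))
        ≡⟨ ∑-cong (subgraphs n) (λ s → ∑-cong maps (λ f → trans (*-comm _ ⌊ isHom G H f ⌋) (sym (⌊∧⌋ (isHom G H f) _)))) ⟩
      ∑ (subgraphs n) (λ s → ∑ maps (λ f → ⌊ hasImage s f ⌋))                     ≡⟨ ∑-cong (subgraphs n) ∑-hasImage ⟩
      ∑ (subgraphs n) (λ s → ⌊ isSubgraphOf H s ⌋ * surj G (toGraph s))         ∎
    where open ≡-Reasoning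

edges : Graph → ℕ
edges G = ∑ (allFin (size G)) (λ x → ∑ (allFin (size G)) (λ y → ⌊ adj G x y ⌋))

weight : Graph → ℕ
weight G = size G + edges G

Iso-size : ∀ {G H} → Iso G H → size G ≡ size H
Iso-size (f , g , gf≗id , fg≗id , _) =
  ≤-antisym (injective⇒≤ (λ {x} {y} fx≡fy → trans (sym (gf≗id x)) (trans (cong g fx≡fy) (gf≗id y))))
            (injective⇒≤ (λ {x} {y} gx≡gy → trans (sym (fg≗id x)) (trans (cong f gx≡gy) (fg≗id y))))

Iso-weight : ∀ {G H} → Iso G H → weight G ≡ weight H
Iso-weight {G} {H} i@(f , g , gf≗id , fg≗id , f-adj) = cong₂ _+_ (Iso-size {G} {H} i) (begin
    edges G
      ≡⟨ ∑-cong (allFin (size G)) (λ x → ∑-cong (allFin (size G)) (λ y → cong ⌊_⌋ (sym (f-adj x y)))) ⟩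
    ∑ (allFin (size G)) (λ x → ∑ (allFin (size G)) (λ y → ⌊ adj H (f x) (f y) ⌋))
      ≡⟨ ∑-cong (allFin (size G)) (λ x → ∑-bijection f g gf≗id fg≗id (λ v → ⌊ adj H (f x) v ⌋)) ⟩
    ∑ (allFin (size G)) (λ x → ∑ (allFin (size H)) (λ v → ⌊ adj H (f x) v ⌋))
      ≡⟨ ∑-bijection f g gf≗id fg≗id (λ u → ∑ (allFin (size H)) (λ v → ⌊ adj H u v ⌋)) ⟩
    edges H                                                                       ∎)
  where open ≡-Reasoning

⌊⌋-injective : ∀ a b → ⌊ a ⌋ ≡ ⌊ b ⌋ → a ≡ b
⌊⌋-injective true  true  _ = refl
⌊⌋-injective false false _ = refl

whole : ∀ H → Subgraph (size H)
whole H = (λ _ → true) , adj H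

whole-isSubgraphOf : ∀ H → IsSubgraphOf H (whole H)
whole-isSubgraphOf H u v uv = tt , tt , uv , subst T (adj-sym H u v) uv

module SubgraphWeight (H : Graph) (U : Fin (size H) → Bool) (E : Fin (size H) → Fin (size H) → Bool)
                      (sub : IsSubgraphOf H (U , E)) where
  private
    s = (U , E)
    vertices = allFin (size H)

  edges-toGraph : edges (toGraph s) ≡ ∑ vertices (λ u → ∑ vertices (λ v → ⌊ E u v ⌋))
  edges-toGraph = begin
      edges (toGraph s)
        ≡⟨ ∑-cong (allFin (card U)) (λ a → ∑-embed U (λ v → ⌊ E (embed U a) v ∧ E v (embed U a) ⌋)) ⟩
      ∑ (allFin (card U)) (λ a → ∑ vertices (λ v → ⌊ U v ⌋ * ⌊ E (embed U a) v ∧ E v (embed U a) ⌋))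
        ≡⟨ ∑-embed U (λ u → ∑ vertices (λ v → ⌊ U v ⌋ * ⌊ E u v ∧ E v u ⌋)) ⟩
      ∑ vertices (λ u → ⌊ U u ⌋ * ∑ vertices (λ v → ⌊ U v ⌋ * ⌊ E u v ∧ E v u ⌋))
        ≡⟨ ∑-cong vertices (λ u → trans (sym (∑-*ˡ vertices ⌊ U u ⌋ _)) (∑-cong vertices (edge-indicator u))) ⟩
      ∑ vertices (λ u → ∑ vertices (λ v → ⌊ E u v ⌋))
        ∎
    where
    open ≡-Reasoning
    edge-indicator : ∀ u v → ⌊ U u ⌋ * (⌊ U v ⌋ * ⌊ E u v ∧ E v u ⌋) ≡ ⌊ E u v ⌋
    edge-indicator u v with E u v in uv
    ... | false = trans (cong (⌊ U u ⌋ *_) (*-zeroʳ ⌊ U v ⌋)) (*-zeroʳ ⌊ U u ⌋)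
    ... | true  = let (Uu , Uv , _ , vu) = sub u v (≡true⇒T uv) in
      trans (cong₂ (λ x y → ⌊ x ⌋ * (⌊ y ⌋ * ⌊ true ∧ E v u ⌋)) (T⇒≡true Uu) (T⇒≡true Uv)) (cong (λ z → ⌊ z ⌋ + 0 + 0) (T⇒≡true vu))

  private
    E≤adj : ∀ u v → ⌊ E u v ⌋ ≤ ⌊ adj H u v ⌋
    E≤adj u v with E u v in uv
    ... | false = z≤n
    ... | true  = ≤-reflexive (sym (⌊T⌋ (proj₁ (proj₂ (proj₂ (sub u v (≡true⇒T uv)))))))

    size-≤ : size (toGraph s) ≤ size H
    size-≤ = ≤-trans (≤-reflexive (card≡∑ U)) (≤-trans (∑-mono-≤ vertices (⌊⌋≤1 ∘ U)) (≤-reflexive (∑-allFin-1 (size H))))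

    edges-≤ : edges (toGraph s) ≤ edges H
    edges-≤ = ≤-trans (≤-reflexive edges-toGraph) (∑-mono-≤ vertices (λ u → ∑-mono-≤ vertices (E≤adj u)))

  weight-≤ : weight (toGraph s) ≤ weight H
  weight-≤ = +-mono-≤ size-≤ edges-≤

  weight-≡⇒whole : weight (toGraph s) ≡ weight H → (∀ u → T (U u)) × (∀ u v → E u v ≡ adj H u v)
  weight-≡⇒whole w≡w = all-vertices , all-edges
    where
    parts = +-≤-≡-split size-≤ edges-≤ w≡w
    all-vertices : ∀ u → T (U u)
    all-vertices u = subst T (⌊⌋-injective true (U u) (sym (∑-mono-≤-≡⇒≗ (size H) _ _ (⌊⌋≤1 ∘ U)
      (trans (sym (card≡∑ U)) (trans (proj₁ parts) (sym (∑-allFin-1 (size H))))) u))) tt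
    row : ∀ u → ∑ vertices (λ v → ⌊ E u v ⌋) ≡ ∑ vertices (λ v → ⌊ adj H u v ⌋)
    row = ∑-mono-≤-≡⇒≗ (size H) _ _ (λ u → ∑-mono-≤ vertices (E≤adj u)) (trans (sym edges-toGraph) (proj₂ parts))
    all-edges : ∀ u v → E u v ≡ adj H u v
    all-edges u v = ⌊⌋-injective _ _ (∑-mono-≤-≡⇒≗ (size H) _ _ (E≤adj u) (row u) v)

  whole⇒Iso : (∀ u → T (U u)) → (∀ u v → E u v ≡ adj H u v) → Iso (toGraph s) H
  whole⇒Iso all-vertices all-edges =
    embed U , embed⁻¹ ,
    (λ a → embed-injective U _ _ (proj₂ (embed-onto U (embed U a) (all-vertices (embed U a))))) ,
    (λ u → proj₂ (embed-onto U u (all-vertices u))) ,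
    (λ a b → sym (trans (cong₂ _∧_ (all-edges (embed U a) (embed U b)) (trans (all-edges (embed U b) (embed U a)) (adj-sym H _ _)))
                        (Bool.∧-idem _)))
    where
    embed⁻¹ : Fin (size H) → Fin (card U)
    embed⁻¹ u = proj₁ (embed-onto U u (all-vertices u))

module _ (G H : Graph) where
  private
    a = size G
    b = size H

  isIsoPair : (Fin a → Fin b) → (Fin b → Fin a) → Bool
  isIsoPair f g = all (λ x → does (g (f x) ≟ x)) (allFin a) ∧ all (λ y → does (f (g y) ≟ y)) (allFin b) ∧
                  all (λ x → all (λ y → does (adj H (f x) (f y) Bool.≟ adj G x y)) (allFin a)) (allFin a)

  isIso : Bool
  isIso = any (λ f → any (isIsoPair f) (allFuns b a)) (allFuns a b)

  T-isIso⁻ : T isIso → Iso G H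
  T-isIso⁻ t =
    let (f , t′) = T-any⁻ _ (allFuns a b) t ; (g , t″) = T-any⁻ _ (allFuns b a) t′
        (gf≗id , rest) = T-∧⁻ {all (λ x → does (g (f x) ≟ x)) (allFin a)} t″
        (fg≗id , f-adj) = T-∧⁻ {all (λ y → does (f (g y) ≟ y)) (allFin b)} rest in
    f , g , (λ x → T-does⁻ (g (f x) ≟ x) (T-all⁻ _ gf≗id x)) , (λ y → T-does⁻ (f (g y) ≟ y) (T-all⁻ _ fg≗id y)) ,
    (λ x y → T-does⁻ (adj H (f x) (f y) Bool.≟ adj G x y) (T-all⁻ _ (T-all⁻ _ f-adj x) y))

  T-isIso⁺ : Iso G H → T isIso
  T-isIso⁺ (f , g , gf≗id , fg≗id , f-adj) =
    any-mono (λ f' → _≈ᵇ_ (mapSetoid a b) f' f) _ (allFuns a b) f-pair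
      (∑⌊⌋-pos⇒T-any _ (allFuns a b) (≤-reflexive (sym (allFuns-enumerates a b f))))
    where
    f-pair : ∀ f' → T (_≈ᵇ_ (mapSetoid a b) f' f) → T (any (isIsoPair f') (allFuns b a))
    f-pair f' t = any-mono (λ g' → _≈ᵇ_ (mapSetoid b a) g' g) _ (allFuns b a) g-pair
                    (∑⌊⌋-pos⇒T-any _ (allFuns b a) (≤-reflexive (sym (allFuns-enumerates b a g))))
      where
      f'≗f = T-does⁻ (DecSetoid._≟_ (mapSetoid a b) f' f) t
      g-pair : ∀ g' → T (_≈ᵇ_ (mapSetoid b a) g' g) → T (isIsoPair f' g')
      g-pair g' t′ = T-∧⁺ {all (λ x → does (g' (f' x) ≟ x)) (allFin a)}
          (T-all⁺ _ (λ x → T-does⁺ (g' (f' x) ≟ x) (trans (g'≗g (f' x)) (trans (cong g (f'≗f x)) (gf≗id x)))))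
          (T-∧⁺ {all (λ y → does (f' (g' y) ≟ y)) (allFin b)}
            (T-all⁺ _ (λ y → T-does⁺ (f' (g' y) ≟ y) (trans (f'≗f (g' y)) (trans (cong f (g'≗g y)) (fg≗id y)))))
            (T-all⁺ _ (λ x → T-all⁺ _ (λ y → T-does⁺ (adj H (f' x) (f' y) Bool.≟ adj G x y)
                                                       (trans (cong₂ (adj H) (f'≗f x) (f'≗f y)) (f-adj x y))))))
        where g'≗g = T-does⁻ (DecSetoid._≟_ (mapSetoid b a) g' g) t′

module Matrices (k : ℕ) where

  Matrix : Set
  Matrix = Fin k → Fin k → ℕ

  infixl 7 _·_
  _·_ : Matrix → Matrix → Matrix
  _·_ = mulEntry

  infixl 6 _⊕_
  _⊕_ : Matrix → Matrix → Matrix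
  (A ⊕ B) i j = A i j + B i j

  𝟎 : Matrix
  𝟎 i j = 0

  infix 4 _≐_
  _≐_ : Matrix → Matrix → Set
  A ≐ B = ∀ i j → A i j ≡ B i j

  private
    indices = allFin k

    δ≡⌊≟⌋ : ∀ (i j : Fin k) → δ i j ≡ ⌊ does (i ≟ j) ⌋
    δ≡⌊≟⌋ i j with i ≟ j
    ... | yes _ = refl
    ... | no _  = refl

    δ-sym : ∀ (i j : Fin k) → δ i j ≡ δ j i
    δ-sym i j with i ≟ j | j ≟ i
    ... | yes _   | yes _   = refl
    ... | no _    | no _    = refl
    ... | yes i≡j | no j≢i = ⊥-elim (j≢i (sym i≡j))
    ... | no i≢j  | yes j≡i = ⊥-elim (i≢j (sym j≡i))

    δ≡⌊≟⌋′ : ∀ (i l : Fin k) → δ i l ≡ ⌊ does (l ≟ i) ⌋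
    δ≡⌊≟⌋′ i l = trans (δ-sym i l) (δ≡⌊≟⌋ l i)

  open Enumeration (finSetoid k) using (∑-select)

  ·-identityˡ : ∀ A → δ · A ≐ A
  ·-identityˡ A i j = trans (∑-cong indices (λ l → cong (_* A l j) (δ≡⌊≟⌋′ i l)))
                            (∑-select indices i (allFin-enumerates k i) (λ l → A l j) (cong (λ z → A z j)))

  ·-identityʳ : ∀ A → A · δ ≐ A
  ·-identityʳ A i j = trans (∑-cong indices (λ l → trans (*-comm (A i l) (δ l j)) (cong (_* A i l) (δ≡⌊≟⌋ l j))))
                            (∑-select indices j (allFin-enumerates k j) (A i) (cong (A i)))

  ·-cong : ∀ {A A' B B'} → A ≐ A' → B ≐ B' → A · B ≐ A' · B'
  ·-cong A≐A' B≐B' i j = ∑-cong indices (λ l → cong₂ _*_ (A≐A' i l) (B≐B' l j))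

  ·-assoc : ∀ A B C → (A · B) · C ≐ A · (B · C)
  ·-assoc A B C i j = begin
      ∑ indices (λ l → ∑ indices (λ m → A i m * B m l) * C l j)
        ≡⟨ ∑-cong indices (λ l → sym (∑-*ʳ indices (C l j) _)) ⟩
      ∑ indices (λ l → ∑ indices (λ m → A i m * B m l * C l j))
        ≡⟨ ∑-comm indices indices _ ⟩
      ∑ indices (λ m → ∑ indices (λ l → A i m * B m l * C l j))
        ≡⟨ ∑-cong indices (λ m → ∑-cong indices (λ l → *-assoc (A i m) _ _)) ⟩
      ∑ indices (λ m → ∑ indices (λ l → A i m * (B m l * C l j)))
        ≡⟨ ∑-cong indices (λ m → ∑-*ˡ indices (A i m) _) ⟩
      ∑ indices (λ m → A i m * ∑ indices (λ l → B m l * C l j)) ∎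
    where open ≡-Reasoning

  ·-distribʳ-⊕ : ∀ A B C → (A ⊕ B) · C ≐ A · C ⊕ B · C
  ·-distribʳ-⊕ A B C i j = trans (∑-cong indices (λ l → *-distribʳ-+ (C l j) (A i l) (B i l))) (∑-+ indices _ _)

  ·-distribˡ-⊕ : ∀ A B C → A · (B ⊕ C) ≐ A · B ⊕ A · C
  ·-distribˡ-⊕ A B C i j = trans (∑-cong indices (λ l → *-distribˡ-+ (A i l) (B l j) (C l j))) (∑-+ indices _ _)

  ·-zeroʳ : ∀ A → A · 𝟎 ≐ 𝟎
  ·-zeroʳ A i j = ∑-≡0 indices (λ l → *-zeroʳ (A i l))

  ·-zeroˡ : ∀ A → 𝟎 · A ≐ 𝟎
  ·-zeroˡ A i j = ∑-≡0 indices (λ _ → refl)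

  module ModP (p : ℕ) where
    open Congruence p

    infix 4 _≋ₘ_
    _≋ₘ_ : Matrix → Matrix → Set
    A ≋ₘ B = ∀ i j → A i j ≋ B i j

    ≋ₘ-refl : ∀ {A} → A ≋ₘ A
    ≋ₘ-refl i j = ≋-refl

    ≋ₘ-sym : ∀ {A B} → A ≋ₘ B → B ≋ₘ A
    ≋ₘ-sym A≋B i j = ≋-sym (A≋B i j)

    ≋ₘ-trans : ∀ {A B C} → A ≋ₘ B → B ≋ₘ C → A ≋ₘ C
    ≋ₘ-trans A≋B B≋C i j = ≋-trans (A≋B i j) (B≋C i j)

    ≐⇒≋ₘ : ∀ {A B} → A ≐ B → A ≋ₘ B
    ≐⇒≋ₘ A≐B i j = ≡⇒≋ (A≐B i j)

    ·-cong-≋ₘ : ∀ {A A' B B'} → A ≋ₘ A' → B ≋ₘ B' → A · B ≋ₘ A' · B'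
    ·-cong-≋ₘ A≋A' B≋B' i j = ∑-cong-≋ indices (λ l → ≋-*-cong (A≋A' i l) (B≋B' l j))

    ≋ₘ-setoid : Setoid 0ℓ 0ℓ
    ≋ₘ-setoid = record { Carrier = Matrix ; _≈_ = _≋ₘ_ ; isEquivalence = record { refl = ≋ₘ-refl ; sym = ≋ₘ-sym ; trans = ≋ₘ-trans } }

    Invertible : Matrix → Set
    Invertible X = Σ Matrix λ Y → (X · Y ≋ₘ δ) × (Y · X ≋ₘ δ)

    left∧right-inverse⇒Invertible : ∀ X Yˡ Yʳ → Yˡ · X ≋ₘ δ → X · Yʳ ≋ₘ δ → Invertible X
    left∧right-inverse⇒Invertible X Yˡ Yʳ left right = Yˡ , ≋ₘ-trans (·-cong-≋ₘ (≋ₘ-refl {X}) Yˡ≋Yʳ) right , left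
      where
      open SetoidReasoning ≋ₘ-setoid
      Yˡ≋Yʳ : Yˡ ≋ₘ Yʳ
      Yˡ≋Yʳ = begin
        Yˡ            ≈⟨ ≐⇒≋ₘ (·-identityʳ Yˡ) ⟨
        Yˡ · δ        ≈⟨ ·-cong-≋ₘ (≋ₘ-refl {Yˡ}) right ⟨
        Yˡ · (X · Yʳ) ≈⟨ ≐⇒≋ₘ (·-assoc Yˡ X Yʳ) ⟨
        Yˡ · X · Yʳ   ≈⟨ ·-cong-≋ₘ left (≋ₘ-refl {Yʳ}) ⟩
        δ · Yʳ        ≈⟨ ≐⇒≋ₘ (·-identityˡ Yʳ) ⟩
        Yʳ            ∎

    Invertible-· : ∀ A B → Invertible A → Invertible B → Invertible (A · B)
    Invertible-· A B (A⁻¹ , AA⁻¹ , A⁻¹A) (B⁻¹ , BB⁻¹ , B⁻¹B) = B⁻¹ · A⁻¹ , right , left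
      where
      open SetoidReasoning ≋ₘ-setoid
      right : A · B · (B⁻¹ · A⁻¹) ≋ₘ δ
      right = begin
        A · B · (B⁻¹ · A⁻¹)   ≈⟨ ≐⇒≋ₘ (·-assoc A B (B⁻¹ · A⁻¹)) ⟩
        A · (B · (B⁻¹ · A⁻¹)) ≈⟨ ·-cong-≋ₘ (≋ₘ-refl {A}) (≐⇒≋ₘ (·-assoc B B⁻¹ A⁻¹)) ⟨
        A · (B · B⁻¹ · A⁻¹)   ≈⟨ ·-cong-≋ₘ (≋ₘ-refl {A}) (·-cong-≋ₘ BB⁻¹ (≋ₘ-refl {A⁻¹})) ⟩
        A · (δ · A⁻¹)         ≈⟨ ·-cong-≋ₘ (≋ₘ-refl {A}) (≐⇒≋ₘ (·-identityˡ A⁻¹)) ⟩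
        A · A⁻¹               ≈⟨ AA⁻¹ ⟩
        δ                     ∎
      left : B⁻¹ · A⁻¹ · (A · B) ≋ₘ δ
      left = begin
        B⁻¹ · A⁻¹ · (A · B)   ≈⟨ ≐⇒≋ₘ (·-assoc B⁻¹ A⁻¹ (A · B)) ⟩
        B⁻¹ · (A⁻¹ · (A · B)) ≈⟨ ·-cong-≋ₘ (≋ₘ-refl {B⁻¹}) (≐⇒≋ₘ (·-assoc A⁻¹ A B)) ⟨
        B⁻¹ · (A⁻¹ · A · B)   ≈⟨ ·-cong-≋ₘ (≋ₘ-refl {B⁻¹}) (·-cong-≋ₘ A⁻¹A (≋ₘ-refl {B})) ⟩
        B⁻¹ · (δ · B)         ≈⟨ ·-cong-≋ₘ (≋ₘ-refl {B⁻¹}) (≐⇒≋ₘ (·-identityˡ B)) ⟩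
        B⁻¹ · B               ≈⟨ B⁻¹B ⟩
        δ                     ∎

    Invertible-resp-≋ₘ : ∀ {A B} → A ≋ₘ B → Invertible B → Invertible A
    Invertible-resp-≋ₘ {A} {B} A≋B (B⁻¹ , BB⁻¹ , B⁻¹B) =
      B⁻¹ , ≋ₘ-trans (·-cong-≋ₘ A≋B (≋ₘ-refl {B⁻¹})) BB⁻¹ , ≋ₘ-trans (·-cong-≋ₘ (≋ₘ-refl {B⁻¹}) A≋B) B⁻¹B

    Invertible⇒NonsingularMod : ∀ {M} → Invertible M → NonsingularMod p M
    Invertible⇒NonsingularMod (M⁻¹ , MM⁻¹≋δ , M⁻¹M≋δ) =
      M⁻¹ , (λ i j → ≋⇒≡[mod] (MM⁻¹≋δ i j)) , (λ i j → ≋⇒≡[mod] (M⁻¹M≋δ i j))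

    -- Triangularity is with respect to an arbitrary ranking of the indices: entry (a, b) off the
    -- diagonal may be nonzero only when b has smaller rank than a.
    module _ (p-prime : Prime p) where
      private
        q = proj₁ (prime≡suc p-prime)
        p≡1+q = proj₂ (prime≡suc p-prime)

      -- The inverse of Z = I − N is the finite geometric series ∑ₜ Nᵗ, as N is nilpotent;
      -- q = p − 1 plays the role of −1.
      module Unitriangular (Z : Matrix) (rank : Fin k → ℕ) (diag≋1 : ∀ a → Z a a ≋ 1)
                           (lower : ∀ a b → a ≢ b → ¬ (rank b < rank a) → Z a b ≋ 0) where

        N : Matrix
        N a b = if rank b <ᵇ rank a then q * Z a b else 0

        Z⊕N≋δ : Z ⊕ N ≋ₘ δ
        Z⊕N≋δ a b with rank b <ᵇ rank a in b<ᵇa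
        ... | true = ≋-trans (≡⇒≋ (trans (cong (_* Z a b) (sym p≡1+q)) (*-comm p (Z a b)))) (≋-trans (*p≋0 (Z a b)) (≡⇒≋ (sym δab≡0)))
          where
          δab≡0 : δ a b ≡ 0
          δab≡0 with a ≟ b
          ... | yes refl = ⊥-elim (<-irrefl refl (<ᵇ⇒< (rank b) (rank a) (≡true⇒T b<ᵇa)))
          ... | no _     = refl
        ... | false with a ≟ b
        ...   | yes refl = ≋-trans (≡⇒≋ (+-identityʳ (Z a a))) (diag≋1 a)
        ...   | no a≢b   = ≋-trans (≡⇒≋ (+-identityʳ (Z a b))) (lower a b a≢b (λ b<a → subst T b<ᵇa (<⇒<ᵇ b<a)))

        N^ : ℕ → Matrix
        N^ zero    = δ
        N^ (suc t) = N · N^ t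

        N^-vanishes : ∀ t a b → rank a < t + rank b → N^ t a b ≡ 0
        N^-vanishes zero    a b a<b with a ≟ b
        ... | yes refl = ⊥-elim (<-irrefl refl a<b)
        ... | no _     = refl
        N^-vanishes (suc t) a b a<1+t+b = ∑-≡0 indices term
          where
          term : ∀ l → N a l * N^ t l b ≡ 0
          term l with rank l <ᵇ rank a in l<ᵇa
          ... | false = refl
          ... | true  = trans (cong (q * Z a l *_) (N^-vanishes t l b (<-≤-trans (<ᵇ⇒< (rank l) (rank a) (≡true⇒T l<ᵇa)) (≤-pred a<1+t+b))))
                              (*-zeroʳ (q * Z a l))

        geometric : ℕ → Matrix
        geometric zero    = 𝟎
        geometric (suc t) = δ ⊕ N · geometric t

        geometric-suc : ∀ t → δ ⊕ N · geometric t ≐ geometric t ⊕ N^ t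
        geometric-suc zero    i j = trans (cong (δ i j +_) (·-zeroʳ N i j)) (+-identityʳ _)
        geometric-suc (suc t) i j = begin
            δ i j + (N · (δ ⊕ N · geometric t)) i j
              ≡⟨ cong (δ i j +_) (·-cong {N} {N} (λ _ _ → refl) (geometric-suc t) i j) ⟩
            δ i j + (N · (geometric t ⊕ N^ t)) i j
              ≡⟨ cong (δ i j +_) (·-distribˡ-⊕ N (geometric t) (N^ t) i j) ⟩
            δ i j + ((N · geometric t) i j + (N · N^ t) i j)
              ≡⟨ sym (+-assoc (δ i j) _ _) ⟩
            δ i j + (N · geometric t) i j + (N · N^ t) i j ∎
          where open ≡-Reasoning

        N-geometric-comm : ∀ t → N · geometric t ≐ geometric t · N
        N-geometric-comm zero    i j = trans (·-zeroʳ N i j) (sym (·-zeroˡ N i j))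
        N-geometric-comm (suc t) i j = begin
            (N · (δ ⊕ N · geometric t)) i j               ≡⟨ ·-distribˡ-⊕ N δ (N · geometric t) i j ⟩
            (N · δ) i j + (N · (N · geometric t)) i j     ≡⟨ cong₂ _+_ (trans (·-identityʳ N i j) (sym (·-identityˡ N i j)))
                                                                     (·-cong {N} {N} (λ _ _ → refl) (N-geometric-comm t) i j) ⟩
            (δ · N) i j + (N · (geometric t · N)) i j     ≡⟨ cong ((δ · N) i j +_) (sym (·-assoc N (geometric t) N i j)) ⟩
            (δ · N) i j + (N · geometric t · N) i j       ≡⟨ sym (·-distribʳ-⊕ δ (N · geometric t) N i j) ⟩
            ((δ ⊕ N · geometric t) · N) i j               ∎
          where open ≡-Reasoning

        Z⁻¹ : Matrix
        Z⁻¹ = geometric (suc (∑ indices rank))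

        Z⁻¹-fixed : Z⁻¹ ≐ δ ⊕ N · Z⁻¹
        Z⁻¹-fixed i j = sym (trans (geometric-suc (suc R) i j)
                                   (trans (cong (Z⁻¹ i j +_) (N^-vanishes (suc R) i j (s≤s (≤-trans (∑-allFin-≥ k rank i) (m≤m+n R (rank j))))))
                                          (+-identityʳ _)))
          where R = ∑ indices rank

        Z·Z⁻¹≋δ : Z · Z⁻¹ ≋ₘ δ
        Z·Z⁻¹≋δ i j = ≋-cancelʳ-+ ((N · Z⁻¹) i j) (≋-trans (≡⇒≋ (sym (·-distribʳ-⊕ Z N Z⁻¹ i j)))
          (≋-trans (·-cong-≋ₘ Z⊕N≋δ (≋ₘ-refl {Z⁻¹}) i j) (≡⇒≋ (trans (·-identityˡ Z⁻¹ i j) (Z⁻¹-fixed i j)))))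

        Z⁻¹·Z≋δ : Z⁻¹ · Z ≋ₘ δ
        Z⁻¹·Z≋δ i j = ≋-cancelʳ-+ ((Z⁻¹ · N) i j) (≋-trans (≡⇒≋ (sym (·-distribˡ-⊕ Z⁻¹ Z N i j)))
          (≋-trans (·-cong-≋ₘ (≋ₘ-refl {Z⁻¹}) Z⊕N≋δ i j)
                   (≡⇒≋ (trans (·-identityʳ Z⁻¹ i j) (trans (Z⁻¹-fixed i j) (cong (δ i j +_) (N-geometric-comm (suc (∑ indices rank)) i j)))))))

        Z-Invertible : Invertible Z
        Z-Invertible = Z⁻¹ , Z·Z⁻¹≋δ , Z⁻¹·Z≋δ

      -- Scaling the rows (or columns) by the inverses of the diagonal entries makes X unitriangular.
      triangular-Invertible : ∀ X (rank : Fin k → ℕ) → (∀ a b → a ≢ b → ¬ (rank b < rank a) → X a b ≋ 0) →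
                              (∀ a → ¬ (p ∣ X a a)) → Invertible X
      triangular-Invertible X rank lower diag≢0 =
        left∧right-inverse⇒Invertible X (Zˡ⁻¹ · D) (D · Zʳ⁻¹)
          (≋ₘ-trans (≐⇒≋ₘ (·-assoc Zˡ⁻¹ D X)) (proj₂ (proj₂ Zˡ-Invertible)))
          (≋ₘ-trans (≐⇒≋ₘ (λ i j → sym (·-assoc X D Zʳ⁻¹ i j))) (proj₁ (proj₂ Zʳ-Invertible)))
        where
        d : Fin k → ℕ
        d a = proj₁ (≋-inverse p-prime (diag≢0 a))
        D : Matrix
        D a b = δ a b * d a
        ∑-diagonal : ∀ (h : Fin k → ℕ) a → ∑ indices (λ l → δ a l * h l) ≡ h a
        ∑-diagonal h a = trans (∑-cong indices (λ l → cong (_* h l) (δ≡⌊≟⌋′ a l))) (∑-select indices a (allFin-enumerates k a) h (cong h))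
        D·X≡ : ∀ a b → (D · X) a b ≡ d a * X a b
        D·X≡ a b = trans (∑-cong indices (λ l → *-assoc (δ a l) (d a) (X l b))) (∑-diagonal (λ l → d a * X l b) a)
        X·D≡ : ∀ a b → (X · D) a b ≡ X a b * d b
        X·D≡ a b = trans (∑-cong indices (λ l → trans (cong (X a l *_) (trans (cong (_* d l) (δ-sym l b)) (*-comm (δ b l) (d l))))
                                                      (trans (sym (*-assoc (X a l) (d l) (δ b l))) (*-comm (X a l * d l) (δ b l)))))
                         (∑-diagonal (λ l → X a l * d l) b)
        module Zˡ = Unitriangular (D · X) rank
          (λ a → ≋-trans (≡⇒≋ (trans (D·X≡ a a) (*-comm (d a) (X a a)))) (proj₂ (≋-inverse p-prime (diag≢0 a))))
          (λ a b a≢b ¬b<a → ≋-trans (≡⇒≋ (D·X≡ a b)) (≋-trans (≋-*-cong (≋-refl {d a}) (lower a b a≢b ¬b<a)) (≡⇒≋ (*-zeroʳ (d a)))))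
        module Zʳ = Unitriangular (X · D) rank
          (λ a → ≋-trans (≡⇒≋ (X·D≡ a a)) (proj₂ (≋-inverse p-prime (diag≢0 a))))
          (λ a b a≢b ¬b<a → ≋-trans (≡⇒≋ (X·D≡ a b)) (≋-*-cong (lower a b a≢b ¬b<a) (≋-refl {d b})))
        Zˡ-Invertible = Zˡ.Z-Invertible
        Zʳ-Invertible = Zʳ.Z-Invertible
        Zˡ⁻¹ = proj₁ Zˡ-Invertible
        Zʳ⁻¹ = proj₁ Zʳ-Invertible

module Nonsingularity (p : ℕ) (p-prime : Prime p) (k : ℕ) (F : Fin k → Graph)
                      (distinct : ∀ i j → i ≢ j → ¬ Iso (F i) (F j))
                      (reduced : ∀ i → OrderReduced p (F i))
                      (closed : ClosedSurjImage p F) where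
  open Congruence p
  open Matrices k
  open ModP p
  open Enumeration (finSetoid k) using (∑-select)

  private
    indices = allFin k

  homMatrix : Matrix
  homMatrix i j = hom (F i) (F j)

  surjMatrix : Matrix
  surjMatrix i l = surj (F i) (F l)

  copies : Matrix
  copies l j = ∑ (subgraphs (size (F j))) (λ s → ⌊ isSubgraphOf (F j) s ∧ isIso (toGraph s) (F l) ⌋)

  Iso⇒≡ : ∀ {l l'} → Iso (F l) (F l') → l ≡ l'
  Iso⇒≡ {l} {l'} l≅l' with l ≟ l'
  ... | yes l≡l' = l≡l'
  ... | no  l≢l' = ⊥-elim (distinct l l' l≢l' l≅l')

  surj≡∑copies : ∀ i G → (∃ λ l₀ → Iso G (F l₀)) → surj (F i) G ≡ ∑ indices (λ l → ⌊ isIso G (F l) ⌋ * surjMatrix i l)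
  surj≡∑copies i G (l₀ , G≅Fl₀) = sym (begin
      ∑ indices (λ l → ⌊ isIso G (F l) ⌋ * surjMatrix i l)
        ≡⟨ ∑-cong indices (λ l → cong (λ b → ⌊ b ⌋ * surjMatrix i l) (isIso≡ l)) ⟩
      ∑ indices (λ l → ⌊ does (l ≟ l₀) ⌋ * surjMatrix i l)
        ≡⟨ ∑-select indices l₀ (allFin-enumerates k l₀) (surjMatrix i) (cong (surjMatrix i)) ⟩
      surjMatrix i l₀
        ≡⟨ surj-respʳ-Iso (F i) {G} {F l₀} G≅Fl₀ ⟨
      surj (F i) G ∎)
    where
    open ≡-Reasoning
    isIso≡ : ∀ l → isIso G (F l) ≡ does (l ≟ l₀)
    isIso≡ l = T⇔T⇒≡ _ _
      (λ t → T-does⁺ (l ≟ l₀) (Iso⇒≡ (Iso-trans {F l} {G} {F l₀} (Iso-sym {G} {F l} (T-isIso⁻ G (F l) t)) G≅Fl₀)))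
      (λ t → T-isIso⁺ G (F l) (subst (λ z → Iso G (F z)) (sym (T-does⁻ (l ≟ l₀) t)) G≅Fl₀))

  -- Either p divides surj(Fᵢ, G), or G has no automorphism of order p and closure makes G a unique Fₗ.
  surj≋∑copies : ∀ i G → surj (F i) G ≋ ∑ indices (λ l → ⌊ isIso G (F l) ⌋ * surjMatrix i l)
  surj≋∑copies i G with p ∣? surj (F i) G
  ... | yes p∣surj = ≋-trans (∣⇒≋0 p∣surj) (≋-sym (≋-trans (∑-cong-≋ indices term≋0) (≡⇒≋ (∑-≡0 indices (λ _ → refl)))))
    where
    term≋0 : ∀ l → ⌊ isIso G (F l) ⌋ * surjMatrix i l ≋ 0
    term≋0 l with isIso G (F l) in G≅Fl
    ... | false = ≋-refl
    ... | true  = ≋-trans (≡⇒≋ (+-identityʳ _))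
                          (∣⇒≋0 (subst (p ∣_) (surj-respʳ-Iso (F i) {G} {F l} (T-isIso⁻ G (F l) (≡true⇒T G≅Fl))) p∣surj))
  ... | no p∤surj = ≡⇒≋ (surj≡∑copies i G (closed i G (λ aut → p∤surj (autOfOrder⇒p∣surj p p-prime (F i) G aut)) p∤surj))

  hom≋surj·copies : homMatrix ≋ₘ surjMatrix · copies
  hom≋surj·copies i j = begin
      hom (F i) (F j)
        ≡⟨ HomDecomposition.hom≡∑surj (F i) (F j) ⟩
      ∑ subs (λ s → ⌊ isSubgraphOf (F j) s ⌋ * surj (F i) (toGraph s))
        ≈⟨ ∑-cong-≋ subs (λ s → ≋-*-cong (≋-refl {⌊ isSubgraphOf (F j) s ⌋}) (surj≋∑copies i (toGraph s))) ⟩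
      ∑ subs (λ s → ⌊ isSubgraphOf (F j) s ⌋ * ∑ indices (λ l → ⌊ isIso (toGraph s) (F l) ⌋ * surjMatrix i l))
        ≡⟨ ∑-cong subs distribute ⟩
      ∑ subs (λ s → ∑ indices (λ l → surjMatrix i l * ⌊ isSubgraphOf (F j) s ∧ isIso (toGraph s) (F l) ⌋))
        ≡⟨ ∑-comm subs indices _ ⟩
      ∑ indices (λ l → ∑ subs (λ s → surjMatrix i l * ⌊ isSubgraphOf (F j) s ∧ isIso (toGraph s) (F l) ⌋))
        ≡⟨ ∑-cong indices (λ l → ∑-*ˡ subs (surjMatrix i l) _) ⟩
      ∑ indices (λ l → surjMatrix i l * copies l j) ∎
    where
    open SetoidReasoning ≋-setoid
    subs = subgraphs (size (F j))
    regroup : ∀ a b m → ⌊ a ⌋ * (⌊ b ⌋ * m) ≡ m * ⌊ a ∧ b ⌋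
    regroup a b m = trans (sym (*-assoc ⌊ a ⌋ ⌊ b ⌋ m)) (trans (cong (_* m) (sym (⌊∧⌋ a b))) (*-comm _ m))
    distribute : ∀ s → ⌊ isSubgraphOf (F j) s ⌋ * ∑ indices (λ l → ⌊ isIso (toGraph s) (F l) ⌋ * surjMatrix i l)
                     ≡ ∑ indices (λ l → surjMatrix i l * ⌊ isSubgraphOf (F j) s ∧ isIso (toGraph s) (F l) ⌋)
    distribute s = trans (sym (∑-*ˡ indices ⌊ isSubgraphOf (F j) s ⌋ (λ l → ⌊ isIso (toGraph s) (F l) ⌋ * surjMatrix i l)))
                         (∑-cong indices (λ l → regroup (isSubgraphOf (F j) s) (isIso (toGraph s) (F l)) (surjMatrix i l)))

  surjMatrix-lower : ∀ a b → a ≢ b → ¬ (size (F b) < size (F a)) → surjMatrix a b ≡ 0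
  surjMatrix-lower a b a≢b ¬b<a with surjMatrix a b in surj≡
  ... | zero  = refl
  ... | suc _ = ⊥-elim (distinct a b a≢b (IsSurjHom⇒Iso (F a) (F b) sameSize f f-surj))
    where
    maps = allFuns (size (F a)) (size (F b))
    some-surjHom = T-any⁻ (isSurjHom (F a) (F b)) maps
      (∑⌊⌋-pos⇒T-any (isSurjHom (F a) (F b)) maps (subst (1 ≤_) (trans (sym surj≡) (surj≡∑ (F a) (F b))) (s≤s z≤n)))
    f = proj₁ some-surjHom
    f-surj = T-isSurjHom⁻ (F a) (F b) f (proj₂ some-surjHom)
    sameSize : size (F a) ≡ size (F b)
    sameSize = ≤-antisym (≮⇒≥ ¬b<a) (surjective⇒≤ f (proj₁ (proj₂ f-surj)))

  surjMatrix-Invertible : Invertible surjMatrix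
  surjMatrix-Invertible = triangular-Invertible p-prime surjMatrix (size ∘ F)
    (λ a b a≢b ¬b<a → ≡⇒≋ (surjMatrix-lower a b a≢b ¬b<a)) (λ a → McKay.p∤surj p p-prime (F a) (reduced a))

  copy-lighter-or-whole : ∀ l j (s : Subgraph (size (F j))) → T (isSubgraphOf (F j) s) → Iso (toGraph s) (F l) →
                          weight (F l) < weight (F j) ⊎ l ≡ j
  copy-lighter-or-whole l j s@(U , E) sub s≅Fl = Sum.map₂ copy-is-whole (m≤n⇒m<n∨m≡n (≤-trans (≤-reflexive (sym s≡Fl)) weight-≤))
    where
    open SubgraphWeight (F j) U E (T-isSubgraphOf⁻ (F j) s sub)
    s≡Fl : weight (toGraph s) ≡ weight (F l)
    s≡Fl = Iso-weight {toGraph s} {F l} s≅Fl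
    copy-is-whole : weight (F l) ≡ weight (F j) → l ≡ j
    copy-is-whole w≡w = let (all-vertices , all-edges) = weight-≡⇒whole (trans s≡Fl w≡w) in
      Iso⇒≡ (Iso-trans {F l} {toGraph s} {F j} (Iso-sym {toGraph s} {F l} s≅Fl) (whole⇒Iso all-vertices all-edges))

  -- The truncated subtraction never truncates: each weight is a summand of the total.
  rank : Fin k → ℕ
  rank l = ∑ indices (weight ∘ F) ∸ weight (F l)

  copies-lower : ∀ l j → l ≢ j → ¬ (rank j < rank l) → copies l j ≡ 0
  copies-lower l j l≢j ¬j<l = ∑-≡0 (subgraphs (size (F j))) (λ s → ⌊¬T⌋ (λ t →
    let (sub , iso) = T-∧⁻ {isSubgraphOf (F j) s} t in
    impossible (copy-lighter-or-whole l j s sub (T-isIso⁻ (toGraph s) (F l) iso))))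
    where
    impossible : weight (F l) < weight (F j) ⊎ l ≡ j → ⊥
    impossible (inj₁ lighter) = ¬j<l (∸-monoʳ-< lighter (∑-allFin-≥ k (weight ∘ F) j))
    impossible (inj₂ l≡j)     = l≢j l≡j

  copies-diagonal : ∀ j → copies j j ≡ 1
  copies-diagonal j = trans (∑-cong (subgraphs n) is-whole) (subgraphs-enumerates n (whole (F j)))
    where
    n = size (F j)
    is-whole : ∀ s → ⌊ isSubgraphOf (F j) s ∧ isIso (toGraph s) (F j) ⌋ ≡ ⌊ _≈ᵇ_ (subgraphSetoid n) s (whole (F j)) ⌋
    is-whole s@(U , E) = cong ⌊_⌋ (T⇔T⇒≡ _ _
      (λ t → let (sub , iso) = T-∧⁻ {isSubgraphOf (F j) s} t
                 open SubgraphWeight (F j) U E (T-isSubgraphOf⁻ (F j) s sub)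
                 (all-vertices , all-edges) = weight-≡⇒whole (Iso-weight {toGraph s} {F j} (T-isIso⁻ (toGraph s) (F j) iso)) in
             T-does⁺ (DecSetoid._≟_ (subgraphSetoid n) s (whole (F j))) (T⇒≡true ∘ all-vertices , all-edges))
      (λ t → let (U≗true , E≗adj) = T-does⁻ (DecSetoid._≟_ (subgraphSetoid n) s (whole (F j))) t
                 sub = subst T (isSubgraphOf-resp (F j) (DecSetoid.sym (subgraphSetoid n) {s} {whole (F j)} (U≗true , E≗adj)))
                                 (T-isSubgraphOf⁺ (F j) (whole (F j)) (whole-isSubgraphOf (F j)))
                 open SubgraphWeight (F j) U E (T-isSubgraphOf⁻ (F j) s sub) in
             T-∧⁺ {isSubgraphOf (F j) s} sub (T-isIso⁺ (toGraph s) (F j) (whole⇒Iso (≡true⇒T ∘ U≗true) E≗adj))))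

  copies-Invertible : Invertible copies
  copies-Invertible = triangular-Invertible p-prime copies rank
    (λ a b a≢b ¬b<a → ≡⇒≋ (copies-lower a b a≢b ¬b<a))
    (λ j p∣copies → ¬∣1 p-prime (subst (p ∣_) (copies-diagonal j) p∣copies))

corollary1p4 : (p : ℕ) → Prime p → (k : ℕ) → 1 ≤ k → (F : Fin k → Graph) →
    (∀ i j → i ≢ j → ¬ Iso (F i) (F j)) →
    (∀ i → OrderReduced p (F i)) →
    ClosedSurjImage p F →
    NonsingularMod p (λ i j → hom (F i) (F j))
corollary1p4 p p-prime k _ F distinct reduced closed =
  Invertible⇒NonsingularMod (Invertible-resp-≋ₘ hom≋surj·copies
                              (Invertible-· surjMatrix copies surjMatrix-Invertible copies-Invertible))
  where
  open Nonsingularity p p-prime k F distinct reduced closed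
  open Matrices.ModP k p using (Invertible-·; Invertible-resp-≋ₘ; Invertible⇒NonsingularMod)
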